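{- In the nice format described below, $\mathrm{3SAT}\in\mathrm{BNAL}[\frac{n}{\log n}]$, where $n$ is the length of the 3SAT formula.
   Context: Binary encoding of 3SAT: a variable $x_i$ is written as the binary number $i$, followed by a sign in $\{+,-\}$ indicating a positive or negated literal; literals in a clause are separated by $|$ (so $(x_i\lor\neg x_j\lor\neg x_k)$ is written $i+|j-|k-$), and clauses are separated by $\&$. Nice format: if the formula has $k$ variables, then they are named by the first $k$ binary numbers $1,\dots,k$, all written with the same length $O(\log k)$. Convolution pairs strings symbol by symbol, padding with a new symbol; a relation is automatic if the set of convolutions of its tuples is regular; it is bounded if there is $c$ with $||y|-|x||\le c$ on it. A Nondeterministic Automatic Register Machine (NARM) has finitely many registers holding strings (initially empty) and a finite program: read input, write, assign constant, copy, assign to a register a value related by a bounded automatic relation to registers (nondeterministic choice), goto, conditional goto on an automatic predicate, halt/accept/reject; each executed instruction is one step; acceptance means some path accepts. $\mathrm{BNAL}[f(n)]$ is the class of languages accepted by a NARM with all accepting paths on inputs of length $n$ taking $O(f(n))$ steps. -}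

module Defs where

open import Data.Nat using (ℕ; zero; suc; _+_; _*_; _∸_; _≤_; _⊔_; pred)
open import Data.Nat.DivMod using (_/_; _%_)
open import Data.Nat.Logarithm using (⌊log₂_⌋)
open import Data.Bool using (Bool; true; false; if_then_else_)
open import Data.Fin using (Fin; zero; suc; _≟_)
open import Data.Maybe using (Maybe; just; nothing)
import Data.Maybe as Maybe
open import Data.List using (List; []; _∷_; _++_; length; intercalate; map; foldr)
open import Data.List.Relation.Unary.All using (All)
open import Data.List.Relation.Unary.Any using (Any)
open import Data.List.Membership.Propositional using (_∈_)
open import Data.Vec using (Vec; []; _∷_)
import Data.Vec as Vec
open import Data.Sum using (_⊎_; inj₁; inj₂)
open import Data.Product using (Σ; ∃; _×_; _,_)
open import Relation.Binary.PropositionalEquality using (_≡_)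
open import Relation.Nullary using (does)
open import Function.Bundles using (_⇔_)

data Sym : Set where
  s0 s1 plus minus bar amp : Sym

-- a literal: variable index and sign (true = positive, written +)
Literal : Set
Literal = ℕ × Bool

Clause : Set
Clause = Literal × Literal × Literal

Formula : Set
Formula = List Clause

clauseLits : Clause → List Literal
clauseLits (a , b , c) = a ∷ b ∷ c ∷ []

vars : Formula → List ℕ
vars [] = []
vars (((i , _) , (j , _) , (k , _)) ∷ φ) = i ∷ j ∷ k ∷ vars φ

-- the big-endian binary representation of i using exactly L digits
-- (leading zeros allowed)
bin : ℕ → ℕ → List Sym
bin zero    i = []
bin (suc L) i = bin L (i / 2) ++ (if does ((i % 2) Data.Nat.≟ 0) then s0 else s1) ∷ []

-- length of the binary representation of k (for k ≥ 1)
bits : ℕ → ℕ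
bits k = suc ⌊log₂ k ⌋

encLit : ℕ → Literal → List Sym
encLit L (i , s) = bin L i ++ (if s then plus else minus) ∷ []

encClause : ℕ → Clause → List Sym
encClause L (a , b , c) = encLit L a ++ bar ∷ encLit L b ++ bar ∷ encLit L c

encFormula : ℕ → Formula → List Sym
encFormula L φ = intercalate (amp ∷ []) (map (encClause L) φ)

HasVars : ℕ → Formula → Set
HasVars k φ = (∀ {v} → v ∈ vars φ → 1 ≤ v × v ≤ k)
            × (∀ i → 1 ≤ i → i ≤ k → i ∈ vars φ)

litTrue : (ℕ → Bool) → Literal → Set
litTrue α (i , s) = α i ≡ s

Satisfiable : Formula → Set
Satisfiable φ = ∃ λ (α : ℕ → Bool) → All (λ cl → Any (litTrue α) (clauseLits cl)) φ

ThreeSATNice : List Sym → Set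
ThreeSATNice w = ∃ λ k → ∃ λ (φ : Formula) →
  HasVars k φ × w ≡ encFormula (bits k) φ × Satisfiable φ

record DFA (B : Set) : Set where
  field
    Q     : ℕ
    start : Fin (suc Q)
    δ     : Fin (suc Q) → B → Fin (suc Q)
    final : Fin (suc Q) → Bool

runDFA : ∀ {B} → (D : DFA B) → Fin (suc (DFA.Q D)) → List B → Fin (suc (DFA.Q D))
runDFA D q []       = q
runDFA D q (b ∷ bs) = runDFA D (DFA.δ D q b) bs

acceptsDFA : ∀ {B} → DFA B → List B → Bool
acceptsDFA D w = DFA.final D (runDFA D (DFA.start D) w)

maxLen : ∀ {A : Set} {k} → Vec (List A) k → ℕ
maxLen = Vec.foldr _ (λ x m → length x ⊔ m) 0

headM : ∀ {A : Set} → List A → Maybe A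
headM []      = nothing
headM (x ∷ _) = just x

tailL : ∀ {A : Set} → List A → List A
tailL []       = []
tailL (_ ∷ xs) = xs

convN : ∀ {A : Set} {k} → ℕ → Vec (List A) k → List (Vec (Maybe A) k)
convN zero    xs = []
convN (suc n) xs = Vec.map headM xs ∷ convN n (Vec.map tailL xs)

-- convolution: symbolwise pairing, padded with a new symbol (nothing)
conv : ∀ {A : Set} {k} → Vec (List A) k → List (Vec (Maybe A) k)
conv xs = convN (maxLen xs) xs

Bounded : ∀ {A : Set} {k} → DFA (Vec (Maybe A) (suc k)) → Set
Bounded {A} {k} D = ∃ λ c → ∀ (y : List A) (xs : Vec (List A) k) →
  acceptsDFA D (conv (y ∷ xs)) ≡ true →
  (length y ≤ maxLen xs + c) × (maxLen xs ≤ length y + c)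

-- Γ: work alphabet (input symbols plus finitely many extra symbols),
-- r registers, p program lines
data Instr (Γ : Set) (r p : ℕ) : Set where
  readIn  : Fin r → Instr Γ r p
  write   : Fin r → Instr Γ r p
  const   : Fin r → List Γ → Instr Γ r p
  copy    : Fin r → Fin r → Instr Γ r p
  choose  : Fin r → (k : ℕ) → Vec (Fin r) k →
            (D : DFA (Vec (Maybe Γ) (suc k))) → Bounded D → Instr Γ r p
            -- R_i := some y with (y, R_j1, ..., R_jk) in the relation
  goto    : Fin p → Instr Γ r p
  ifGoto  : (k : ℕ) → Vec (Fin r) k → DFA (Vec (Maybe Γ) k) → Fin p → Instr Γ r p
            -- if (R_j1..R_jk) satisfies the automatic predicate, goto l
  halt    : Instr Γ r p
  accept  : Instr Γ r p
  reject  : Instr Γ r p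

record NARM : Set where
  field
    extra : ℕ
    nreg  : ℕ
    plen  : ℕ        -- program has suc plen lines
    prog  : Fin (suc plen) → Instr (Sym ⊎ Fin extra) nreg (suc plen)

-- next line; nothing if the program is left at the end
nextPC : ∀ {n} → Fin n → Maybe (Fin n)
nextPC {suc zero}    zero    = nothing
nextPC {suc (suc n)} zero    = just (suc zero)
nextPC {suc (suc n)} (suc i) = Maybe.map suc (nextPC i)

module Semantics (M : NARM) where
  open NARM M

  Γ : Set
  Γ = Sym ⊎ Fin extra

  Regs : Set
  Regs = Fin nreg → List Γ

  Config : Set
  Config = Fin (suc plen) × Regs

  update : Regs → Fin nreg → List Γ → Regs
  update R i v j = if does (j ≟ i) then v else R j

  vals : ∀ {k} → Regs → Vec (Fin nreg) k → Vec (List Γ) k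
  vals R js = Vec.map R js

  -- one executed (non-final) instruction on input x
  data Step (x : List Sym) : Config → Config → Set where
    s-read   : ∀ {pc pc' R i} → prog pc ≡ readIn i → nextPC pc ≡ just pc' →
               Step x (pc , R) (pc' , update R i (map inj₁ x))
    s-write  : ∀ {pc pc' R i} → prog pc ≡ write i → nextPC pc ≡ just pc' →
               Step x (pc , R) (pc' , R)
    s-const  : ∀ {pc pc' R i w} → prog pc ≡ const i w → nextPC pc ≡ just pc' →
               Step x (pc , R) (pc' , update R i w)
    s-copy   : ∀ {pc pc' R i j} → prog pc ≡ copy i j → nextPC pc ≡ just pc' →
               Step x (pc , R) (pc' , update R i (R j))
    s-choose : ∀ {pc pc' R i k js D b} → prog pc ≡ choose i k js D b →
               nextPC pc ≡ just pc' → (y : List Γ) →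
               acceptsDFA D (conv (y ∷ vals R js)) ≡ true →
               Step x (pc , R) (pc' , update R i y)
    s-goto   : ∀ {pc R l} → prog pc ≡ goto l → Step x (pc , R) (l , R)
    s-ifT    : ∀ {pc R k js D l} → prog pc ≡ ifGoto k js D l →
               acceptsDFA D (conv (vals R js)) ≡ true → Step x (pc , R) (l , R)
    s-ifF    : ∀ {pc pc' R k js D l} → prog pc ≡ ifGoto k js D l →
               acceptsDFA D (conv (vals R js)) ≡ false → nextPC pc ≡ just pc' →
               Step x (pc , R) (pc' , R)

  -- AccRun x c t : from configuration c there is an accepting path
  -- executing exactly t instructions (the final accept counts as one)
  data AccRun (x : List Sym) : Config → ℕ → Set where
    acc-here : ∀ {pc R} → prog pc ≡ accept → AccRun x (pc , R) 1
    acc-step : ∀ {c c' t} → Step x c c' → AccRun x c' t → AccRun x c (suc t)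

  init : Config
  init = zero , (λ _ → [])

  Accepts : List Sym → Set
  Accepts x = ∃ λ t → AccRun x init t

BNAL : (ℕ → ℕ) → (List Sym → Set) → Set
BNAL f L = Σ NARM λ M → let open Semantics M in
  (∀ x → L x ⇔ Accepts x) ×
  (∃ λ C → ∃ λ n₀ → ∀ x t → n₀ ≤ length x → AccRun x init t → t ≤ C * f (length x))

-- n / log n  (floor log; the divisor is max 1 ⌊log₂ n⌋, equal to ⌊log₂ n⌋ for n ≥ 2)
nOverLog : ℕ → ℕ
nOverLog n = n / suc (pred ⌊log₂ n ⌋)

-- The machine guesses a copy A of the input in which every sign also carries a truth value for
-- its variable, and one automatic test checks that A is well formed and that every clause has a
-- literal made true by these values.  A counter j = 1, …, k is then run over the variable names:
-- the counter register holds A with every name replaced by j, so incrementing all names is a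
-- single bounded automatic guess, and a single automatic test checks that j occurs in A and all
-- its occurrences carry the same value, which is then a satisfying assignment.  Each pass costs
-- four steps; as the k variables are written with ⌊log₂ k⌋ + 1 bits each, n ≥ k (⌊log₂ k⌋ + 1)
-- and so 4 k + 6 = O(n / log n).

module Submission where

open import Defs
open import Data.Nat
  using (ℕ; zero; suc; _+_; _*_; _^_; _∸_; _⊔_; _≤_; _<_; _≤?_; z≤n; s≤s; pred; ⌊_/2⌋; _≡ᵇ_; NonZero; >-nonZero)
open import Data.Nat.Properties
open import Data.Nat.DivMod using (_/_; _%_; m≡m%n+[m/n]*n; m%n<n; m/n*n≤m)
open import Data.Nat.Logarithm using (⌊log₂_⌋; ⌊log₂⌋-mono-≤; ⌊log₂⌊n/2⌋⌋≡⌊log₂n⌋∸1)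
open import Data.Bool using (Bool; true; false; if_then_else_; _∧_; _∨_; not; T)
open import Data.Bool.ListAction using (or)
open import Data.Bool.Properties using (∨-assoc; ∨-identityʳ; ∨-zeroʳ; ∧-assoc; ∧-identityʳ; ∧-zeroʳ)
open import Data.Fin using (Fin; zero; suc; combine; remQuot; #_)
open import Data.Fin.Properties using (remQuot-combine)
open import Data.Maybe using (Maybe; just; nothing; fromMaybe)
open import Data.Maybe.Properties using (just-injective)
open import Data.List using (List; []; _∷_; _++_; length; map; replicate)
open import Data.List.Properties
  using (length-++; length-map; map-++; map-∘; ++-assoc; ++-identityʳ; length-replicate; ∷-injective; map-injective)
open import Data.List.Relation.Unary.All using (All; []; _∷_)
import Data.List.Relation.Unary.All as All
import Data.List.Relation.Unary.All.Properties as All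
import Data.List.Relation.Unary.Any as Any
import Data.List.Relation.Unary.Any.Properties as Any
open import Data.List.Relation.Unary.Any using (Any; here; there)
open import Data.List.Membership.Propositional using (_∈_; find)
open import Data.List.Membership.Propositional.Properties using (∈-map⁺; ∈-map⁻)
open import Data.Vec using (Vec; []; _∷_; lookup)
open import Data.Sum using (_⊎_; inj₁; inj₂; map₂)
open import Data.Sum.Properties using (inj₁-injective; ≡-dec)
open import Data.Product using (Σ; ∃; _×_; _,_; proj₁; proj₂)
open import Data.Unit using (⊤; tt)
open import Data.Empty using (⊥; ⊥-elim)
open import Function using (_∘_)
open import Function.Bundles using (mk⇔)
open import Relation.Nullary using (Dec; does; yes; no; ¬_)
open import Relation.Nullary.Decidable using (dec-true; map′)
open import Relation.Binary.Definitions using (DecidableEquality; tri<; tri≈; tri>)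
open import Data.List.Relation.Binary.Pointwise using (Pointwise; []; _∷_)
open import Relation.Binary.PropositionalEquality

-- Binary numerals

bit : Bool → ℕ
bit false = 0
bit true  = 1

odd : ℕ → Bool
odd i = if does ((i % 2) Data.Nat.≟ 0) then false else true

-- Mirrors Defs.bin: the L-digit big-endian representation of i modulo 2 ^ L.
toBits : ℕ → ℕ → List Bool
toBits zero    i = []
toBits (suc L) i = toBits L (i / 2) ++ odd i ∷ []

fromBits : List Bool → ℕ
fromBits []       = 0
fromBits (b ∷ bs) = bit b * 2 ^ length bs + fromBits bs

digit : Bool → Sym
digit false = s0
digit true  = s1

bit-odd : ∀ i → bit (odd i) ≡ i % 2
bit-odd i with i % 2 | m%n<n i 2
... | zero        | _ = refl
... | suc zero    | _ = refl
... | suc (suc _) | s≤s (s≤s ())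

bin≡map-digit-toBits : ∀ L i → bin L i ≡ map digit (toBits L i)
bin≡map-digit-toBits zero    i = refl
bin≡map-digit-toBits (suc L) i
  rewrite map-++ digit (toBits L (i / 2)) (odd i ∷ []) | bin≡map-digit-toBits L (i / 2) with i % 2
... | zero  = refl
... | suc _ = refl

length-toBits : ∀ L i → length (toBits L i) ≡ L
length-toBits zero    i = refl
length-toBits (suc L) i
  rewrite length-++ (toBits L (i / 2)) {odd i ∷ []} | length-toBits L (i / 2) = +-comm L 1

length-bin : ∀ L i → length (bin L i) ≡ L
length-bin L i = trans (cong length (bin≡map-digit-toBits L i))
                       (trans (length-map digit (toBits L i)) (length-toBits L i))

fromBits<2^length : ∀ ds → fromBits ds < 2 ^ length ds
fromBits<2^length []       = s≤s z≤n
fromBits<2^length (b ∷ ds) = begin-strict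
    bit b * 2 ^ n + fromBits ds  <⟨ +-monoʳ-< (bit b * 2 ^ n) (fromBits<2^length ds) ⟩
    bit b * 2 ^ n + 2 ^ n        ≤⟨ +-monoˡ-≤ (2 ^ n) (*-monoˡ-≤ (2 ^ n) (bit≤1 b)) ⟩
    1 * 2 ^ n + 2 ^ n            ≡⟨ cong (λ m → m + 2 ^ n) (*-identityˡ (2 ^ n)) ⟩
    2 ^ n + 2 ^ n                ≡⟨ cong (2 ^ n +_) (sym (+-identityʳ (2 ^ n))) ⟩
    2 * 2 ^ n                    ∎
  where
    open ≤-Reasoning
    n = length ds
    bit≤1 : ∀ b → bit b ≤ 1
    bit≤1 false = z≤n
    bit≤1 true  = s≤s z≤n

2^length≤fromBits-true : ∀ ds → 2 ^ length ds ≤ fromBits (true ∷ ds)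
2^length≤fromBits-true ds =
  subst (2 ^ length ds ≤_) (cong (_+ fromBits ds) (sym (*-identityˡ (2 ^ length ds))))
        (m≤m+n (2 ^ length ds) (fromBits ds))

2^length≤fromBits⇒leading-true : ∀ b ds → 2 ^ length ds ≤ fromBits (b ∷ ds) → b ≡ true
2^length≤fromBits⇒leading-true false ds le = ⊥-elim (<⇒≱ (fromBits<2^length ds) le)
2^length≤fromBits⇒leading-true true  ds _  = refl

fromBits-snoc : ∀ ds b → fromBits (ds ++ b ∷ []) ≡ 2 * fromBits ds + bit b
fromBits-snoc []       b = trans (+-identityʳ (bit b * 1)) (*-identityʳ (bit b))
fromBits-snoc (d ∷ ds) b
  rewrite fromBits-snoc ds b | length-++ ds {b ∷ []} | +-comm (length ds) 1 = begin
    bit d * (2 * 2 ^ n) + (2 * fromBits ds + bit b)   ≡⟨ cong (_+ (2 * fromBits ds + bit b)) (x*[2*y]≡2*[x*y] (bit d) (2 ^ n)) ⟩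
    2 * (bit d * 2 ^ n) + (2 * fromBits ds + bit b)   ≡⟨ sym (+-assoc (2 * (bit d * 2 ^ n)) (2 * fromBits ds) (bit b)) ⟩
    2 * (bit d * 2 ^ n) + 2 * fromBits ds + bit b     ≡⟨ cong (_+ bit b) (sym (*-distribˡ-+ 2 (bit d * 2 ^ n) (fromBits ds))) ⟩
    2 * (bit d * 2 ^ n + fromBits ds) + bit b         ∎
  where
    open ≡-Reasoning
    n = length ds
    x*[2*y]≡2*[x*y] : ∀ x y → x * (2 * y) ≡ 2 * (x * y)
    x*[2*y]≡2*[x*y] x y = trans (sym (*-assoc x 2 y)) (trans (cong (_* y) (*-comm x 2)) (*-assoc 2 x y))

half<2^L : ∀ L i → i < 2 ^ suc L → i / 2 < 2 ^ L
half<2^L L i i<2^1+L = *-cancelʳ-< _ (i / 2) (2 ^ L)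
  (≤-<-trans (m/n*n≤m i 2) (<-≤-trans i<2^1+L (≤-reflexive (*-comm 2 (2 ^ L)))))

fromBits-toBits : ∀ L i → i < 2 ^ L → fromBits (toBits L i) ≡ i
fromBits-toBits zero    zero    _        = refl
fromBits-toBits zero    (suc i) (s≤s ())
fromBits-toBits (suc L) i       i<2^1+L
  rewrite fromBits-snoc (toBits L (i / 2)) (odd i)
        | fromBits-toBits L (i / 2) (half<2^L L i i<2^1+L) | bit-odd i = begin
    2 * (i / 2) + i % 2   ≡⟨ +-comm (2 * (i / 2)) (i % 2) ⟩
    i % 2 + 2 * (i / 2)   ≡⟨ cong (i % 2 +_) (*-comm 2 (i / 2)) ⟩
    i % 2 + i / 2 * 2     ≡⟨ sym (m≡m%n+[m/n]*n i 2) ⟩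
    i                     ∎
  where open ≡-Reasoning

fromBits-injective : ∀ ds es → length ds ≡ length es → fromBits ds ≡ fromBits es → ds ≡ es
fromBits-injective []       []       _  _ = refl
fromBits-injective (d ∷ ds) (e ∷ es) ≡len ≡val
  with leading d e (suc-injective ≡len) ≡val
  where
    leading : ∀ d e → length ds ≡ length es → fromBits (d ∷ ds) ≡ fromBits (e ∷ es) → d ≡ e
    leading false false _ _ = refl
    leading true  true  _ _ = refl
    leading true false ≡l ≡v
      with () ← 2^length≤fromBits⇒leading-true false es
                  (subst₂ (λ a b → 2 ^ a ≤ b) ≡l ≡v (2^length≤fromBits-true ds))
    leading false true ≡l ≡v
      with () ← 2^length≤fromBits⇒leading-true false ds
                  (subst₂ (λ a b → 2 ^ a ≤ b) (sym ≡l) (sym ≡v) (2^length≤fromBits-true es))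
... | refl = cong (d ∷_) (fromBits-injective ds es (suc-injective ≡len)
  (+-cancelˡ-≡ (bit d * 2 ^ length ds) (fromBits ds) (fromBits es)
    (trans ≡val (cong (λ n → bit d * 2 ^ n + fromBits es) (sym (suc-injective ≡len))))))

toBits-fromBits : ∀ ds → toBits (length ds) (fromBits ds) ≡ ds
toBits-fromBits ds = fromBits-injective _ ds (length-toBits _ _)
  (fromBits-toBits (length ds) (fromBits ds) (fromBits<2^length ds))

fromBits-replicate-false : ∀ n → fromBits (replicate n false) ≡ 0
fromBits-replicate-false zero    = refl
fromBits-replicate-false (suc n) = fromBits-replicate-false n

1+fromBits-replicate-true : ∀ n → suc (fromBits (replicate n true)) ≡ 2 ^ n
1+fromBits-replicate-true zero    = refl
1+fromBits-replicate-true (suc n) rewrite length-replicate n {true} = begin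
    suc ((2 ^ n + 0) + fromBits (replicate n true))  ≡⟨ sym (+-suc (2 ^ n + 0) _) ⟩
    (2 ^ n + 0) + suc (fromBits (replicate n true))  ≡⟨ cong ((2 ^ n + 0) +_) (1+fromBits-replicate-true n) ⟩
    (2 ^ n + 0) + 2 ^ n                               ≡⟨ +-comm (2 ^ n + 0) (2 ^ n) ⟩
    2 ^ n + (2 ^ n + 0)                               ∎
  where open ≡-Reasoning

toBits-zero : ∀ L → toBits L 0 ≡ replicate L false
toBits-zero L = fromBits-injective _ _ (trans (length-toBits L 0) (sym (length-replicate L)))
  (trans (fromBits-toBits L 0 (m^n>0 2 L)) (sym (fromBits-replicate-false L)))

-- Binary logarithm

⌊log₂[2+m]⌋≡1+⌊log₂[1+⌊m/2⌋]⌋ : ∀ m → ⌊log₂ (suc (suc m)) ⌋ ≡ suc ⌊log₂ (suc ⌊ m /2⌋) ⌋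
⌊log₂[2+m]⌋≡1+⌊log₂[1+⌊m/2⌋]⌋ m =
  trans (sym (suc-pred ⌊log₂ (suc (suc m)) ⌋ {{>-nonZero 0<log}}))
        (cong suc (sym (⌊log₂⌊n/2⌋⌋≡⌊log₂n⌋∸1 (suc (suc m)))))
  where
    0<log : 0 < ⌊log₂ (suc (suc m)) ⌋
    0<log = ⌊log₂⌋-mono-≤ {2} {suc (suc m)} (s≤s (s≤s z≤n))

-- Both bounds recurse on ⌊ m /2⌋, so they carry a fuel argument f > n.
private
  2^⌊log₂[1+n]⌋≤1+n : ∀ f n → n < f → 2 ^ ⌊log₂ (suc n) ⌋ ≤ suc n
  2^⌊log₂[1+n]⌋≤1+n (suc f) zero    _        = s≤s z≤n
  2^⌊log₂[1+n]⌋≤1+n (suc f) (suc m) (s≤s m<f) = begin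
      2 ^ ⌊log₂ (suc (suc m)) ⌋        ≡⟨ cong (2 ^_) (⌊log₂[2+m]⌋≡1+⌊log₂[1+⌊m/2⌋]⌋ m) ⟩
      2 * 2 ^ ⌊log₂ (suc ⌊ m /2⌋) ⌋    ≤⟨ *-monoʳ-≤ 2 (2^⌊log₂[1+n]⌋≤1+n f ⌊ m /2⌋ (≤-trans (s≤s (⌊n/2⌋≤n m)) m<f)) ⟩
      2 * suc ⌊ m /2⌋                  ≤⟨ double-half m ⟩
      suc (suc m)                      ∎
    where
      open ≤-Reasoning
      double-half : ∀ m → 2 * suc ⌊ m /2⌋ ≤ suc (suc m)
      double-half zero          = ≤-refl
      double-half (suc zero)    = s≤s (s≤s z≤n)
      double-half (suc (suc m)) = begin
        2 * suc (suc ⌊ m /2⌋)  ≡⟨ *-distribˡ-+ 2 1 (suc ⌊ m /2⌋) ⟩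
        2 + 2 * suc ⌊ m /2⌋    ≤⟨ +-monoʳ-≤ 2 (double-half m) ⟩
        2 + suc (suc m)        ∎

  1+n<2^[1+⌊log₂[1+n]⌋] : ∀ f n → n < f → suc n < 2 ^ suc ⌊log₂ (suc n) ⌋
  1+n<2^[1+⌊log₂[1+n]⌋] (suc f) zero    _        = s≤s (s≤s z≤n)
  1+n<2^[1+⌊log₂[1+n]⌋] (suc f) (suc m) (s≤s m<f) = begin-strict
      suc (suc m)                          <⟨ double-half m ⟩
      2 * suc (suc ⌊ m /2⌋)                ≤⟨ *-monoʳ-≤ 2 (1+n<2^[1+⌊log₂[1+n]⌋] f ⌊ m /2⌋ (≤-trans (s≤s (⌊n/2⌋≤n m)) m<f)) ⟩
      2 * 2 ^ suc ⌊log₂ (suc ⌊ m /2⌋) ⌋    ≡⟨ cong (λ e → 2 ^ suc e) (sym (⌊log₂[2+m]⌋≡1+⌊log₂[1+⌊m/2⌋]⌋ m)) ⟩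
      2 ^ suc ⌊log₂ (suc (suc m)) ⌋        ∎
    where
      open ≤-Reasoning
      double-half : ∀ m → suc (suc m) < 2 * suc (suc ⌊ m /2⌋)
      double-half zero          = s≤s (s≤s (s≤s z≤n))
      double-half (suc zero)    = s≤s (s≤s (s≤s (s≤s z≤n)))
      double-half (suc (suc m)) = begin-strict
        2 + suc (suc m)              <⟨ +-monoʳ-< 2 (double-half m) ⟩
        2 + 2 * suc (suc ⌊ m /2⌋)    ≡⟨ sym (*-distribˡ-+ 2 1 (suc (suc ⌊ m /2⌋))) ⟩
        2 * suc (suc (suc ⌊ m /2⌋))  ∎

2^⌊log₂n⌋≤n : ∀ n → 1 ≤ n → 2 ^ ⌊log₂ n ⌋ ≤ n
2^⌊log₂n⌋≤n (suc n) _ = 2^⌊log₂[1+n]⌋≤1+n (suc n) n ≤-refl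

n<2^[1+⌊log₂n⌋] : ∀ n → n < 2 ^ suc ⌊log₂ n ⌋
n<2^[1+⌊log₂n⌋] zero    = s≤s z≤n
n<2^[1+⌊log₂n⌋] (suc n) = 1+n<2^[1+⌊log₂[1+n]⌋] (suc n) n ≤-refl

⌊log₂⌋-unique : ∀ n m → 2 ^ m ≤ n → n < 2 ^ suc m → ⌊log₂ n ⌋ ≡ m
⌊log₂⌋-unique n m lo hi with <-cmp ⌊log₂ n ⌋ m
... | tri≈ _ eq _ = eq
... | tri< lt _ _ = ⊥-elim (<⇒≱ (<-≤-trans (n<2^[1+⌊log₂n⌋] n) (^-monoʳ-≤ 2 lt)) lo)
... | tri> _ _ gt = ⊥-elim (<⇒≱ (<-≤-trans hi (^-monoʳ-≤ 2 gt)) (2^⌊log₂n⌋≤n n (≤-trans (m^n>0 2 m) lo)))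

n<2^n : ∀ n → n < 2 ^ n
n<2^n zero    = s≤s z≤n
n<2^n (suc n) = begin-strict
    suc n          ≤⟨ n<2^n n ⟩
    2 ^ n          <⟨ m<m+n (2 ^ n) (m^n>0 2 n) ⟩
    2 ^ n + 2 ^ n  ≡⟨ cong (2 ^ n +_) (sym (+-identityʳ (2 ^ n))) ⟩
    2 * 2 ^ n      ∎
  where open ≤-Reasoning

2*n≤2^n : ∀ n → 2 * n ≤ 2 ^ n
2*n≤2^n zero          = z≤n
2*n≤2^n (suc zero)    = ≤-refl
2*n≤2^n (suc (suc n)) = begin
    2 * suc (suc n)          ≡⟨ *-distribˡ-+ 2 1 (suc n) ⟩
    2 + 2 * suc n            ≤⟨ +-mono-≤ (*-monoʳ-≤ 2 (m^n>0 2 n)) (2*n≤2^n (suc n)) ⟩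
    2 ^ suc n + 2 ^ suc n    ≡⟨ cong (2 ^ suc n +_) (sym (+-identityʳ (2 ^ suc n))) ⟩
    2 * 2 ^ suc n            ∎
  where open ≤-Reasoning

-- Running time

lg : ℕ → ℕ
lg n = suc (pred ⌊log₂ n ⌋)

k*d≤2n⇒k≤3[n/d] : ∀ k n d .{{_ : NonZero d}} → d ≤ n → k * d ≤ 2 * n → k ≤ 3 * (n / d)
k*d≤2n⇒k≤3[n/d] k n d d≤n kd≤2n = begin
    k              ≤⟨ ≤-pred (subst (k <_) (+-suc (2 * q) 1) k<2q+2) ⟩
    2 * q + 1      ≤⟨ +-monoʳ-≤ (2 * q) 1≤q ⟩
    2 * q + q      ≡⟨ sym (trans (*-distribʳ-+ q 2 1) (cong (2 * q +_) (*-identityˡ q))) ⟩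
    3 * q          ∎
  where
    open ≤-Reasoning
    q = n / d
    r = n % d
    n≡r+qd : n ≡ r + q * d
    n≡r+qd = m≡m%n+[m/n]*n n d
    k<2q+2 : k < 2 * q + 2
    k<2q+2 = *-cancelʳ-< d k (2 * q + 2) (begin-strict
      k * d                ≤⟨ kd≤2n ⟩
      2 * n                ≡⟨ cong (2 *_) n≡r+qd ⟩
      2 * (r + q * d)      ≡⟨ *-distribˡ-+ 2 r (q * d) ⟩
      2 * r + 2 * (q * d)  <⟨ +-monoˡ-< (2 * (q * d)) (*-monoʳ-< 2 (m%n<n n d)) ⟩
      2 * d + 2 * (q * d)  ≡⟨ cong (2 * d +_) (sym (*-assoc 2 q d)) ⟩
      2 * d + 2 * q * d    ≡⟨ +-comm (2 * d) (2 * q * d) ⟩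
      2 * q * d + 2 * d    ≡⟨ sym (*-distribʳ-+ d (2 * q) 2) ⟩
      (2 * q + 2) * d      ∎)
    1≤q : 1 ≤ q
    1≤q with q | n≡r+qd
    ... | zero  | eq = ⊥-elim (<⇒≱ (m%n<n n d) (subst (d ≤_) (trans eq (+-identityʳ r)) d≤n))
    ... | suc _ | _  = s≤s z≤n

-- Either log n ≤ 2 bits k, or log n = bits k + b with b > bits k and then k * log n < 2 ^ log n ≤ n.
k*bits[k]≤n⇒k*lg[n]≤2n : ∀ k n → 1 ≤ k → k * bits k ≤ n → k * lg n ≤ 2 * n
k*bits[k]≤n⇒k*lg[n]≤2n k n 1≤k kL≤n with ⌊log₂ n ⌋ ≤? bits k + bits k
... | yes a≤2L = begin
    k * lg n         ≤⟨ *-monoʳ-≤ k (lg≤ ⌊log₂ n ⌋ a≤2L) ⟩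
    k * (L + L)      ≡⟨ *-distribˡ-+ k L L ⟩
    k * L + k * L    ≤⟨ +-mono-≤ kL≤n kL≤n ⟩
    n + n            ≡⟨ cong (n +_) (sym (+-identityʳ n)) ⟩
    2 * n            ∎
  where
    open ≤-Reasoning
    L = bits k
    lg≤ : ∀ a → a ≤ L + L → suc (pred a) ≤ L + L
    lg≤ zero    _  = s≤s z≤n
    lg≤ (suc a) le = le
... | no a≰2L = begin
    k * suc (pred a)   ≡⟨ cong (λ x → k * suc (pred x)) a≡L+b ⟩
    k * (L + b)        ≤⟨ *-monoˡ-≤ (L + b) (<⇒≤ (n<2^[1+⌊log₂n⌋] k)) ⟩
    2 ^ L * (L + b)    ≤⟨ *-monoʳ-≤ (2 ^ L) L+b≤2^b ⟩
    2 ^ L * 2 ^ b      ≡⟨ sym (^-distribˡ-+-* 2 L b) ⟩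
    2 ^ (L + b)        ≡⟨ cong (2 ^_) (sym a≡L+b) ⟩
    2 ^ a              ≤⟨ 2^⌊log₂n⌋≤n n (≤-trans (*-mono-≤ 1≤k (s≤s z≤n)) kL≤n) ⟩
    n                  ≤⟨ m≤m+n n (n + 0) ⟩
    2 * n              ∎
  where
    open ≤-Reasoning
    L = bits k
    a = ⌊log₂ n ⌋
    b = a ∸ L
    2L<a : L + L < a
    2L<a = ≰⇒> a≰2L
    a≡L+b : a ≡ L + b
    a≡L+b = sym (m+[n∸m]≡n (≤-trans (m≤m+n L L) (<⇒≤ 2L<a)))
    L<b : L < b
    L<b = +-cancelˡ-< L L b (subst (L + L <_) a≡L+b 2L<a)
    L+b≤2^b : L + b ≤ 2 ^ b
    L+b≤2^b = ≤-trans (+-monoˡ-≤ b (<⇒≤ L<b))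
                (≤-trans (≤-reflexive (cong (b +_) (sym (+-identityʳ b)))) (2*n≤2^n b))

4k+6≤30*nOverLog : ∀ k n → 1 ≤ k → k * bits k ≤ n → 4 * k + 6 ≤ 30 * nOverLog n
4k+6≤30*nOverLog k n 1≤k kL≤n = begin
    4 * k + 6                ≤⟨ +-monoʳ-≤ (4 * k) (*-monoʳ-≤ 6 1≤k) ⟩
    4 * k + 6 * k            ≡⟨ sym (*-distribʳ-+ k 4 6) ⟩
    10 * k                   ≤⟨ *-monoʳ-≤ 10 (k*d≤2n⇒k≤3[n/d] k n (lg n) lg≤n (k*bits[k]≤n⇒k*lg[n]≤2n k n 1≤k kL≤n)) ⟩
    10 * (3 * nOverLog n)    ≡⟨ sym (*-assoc 10 3 (nOverLog n)) ⟩
    30 * nOverLog n          ∎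
  where
    open ≤-Reasoning
    1≤n : 1 ≤ n
    1≤n = ≤-trans (*-mono-≤ 1≤k (s≤s z≤n)) kL≤n
    lg≤n : lg n ≤ n
    lg≤n with ⌊log₂ n ⌋ | 2^⌊log₂n⌋≤n n 1≤n
    ... | zero  | _     = 1≤n
    ... | suc a | 2^a≤n = ≤-trans (<⇒≤ (n<2^n (suc a))) 2^a≤n

-- Finite types and two-tape automata

record Finite (S : Set) : Set where
  field
    bound         : ℕ
    encode        : S → Fin (suc bound)
    decode        : Fin (suc bound) → S
    decode-encode : ∀ s → decode (encode s) ≡ s
open Finite

finite-retract : ∀ {S T} → Finite T → (f : S → T) (g : T → S) → (∀ s → g (f s) ≡ s) → Finite S
finite-retract F f g gf = record
  { bound = bound F ; encode = encode F ∘ f ; decode = g ∘ decode F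
  ; decode-encode = λ s → trans (cong g (decode-encode F (f s))) (gf s) }

finite-⊤ : Finite ⊤
finite-⊤ = record { bound = 0 ; encode = λ _ → zero ; decode = λ _ → tt ; decode-encode = λ _ → refl }

finite-Maybe : ∀ {A} → Finite A → Finite (Maybe A)
finite-Maybe {A} F = record { bound = suc (bound F) ; encode = enc ; decode = dec ; decode-encode = dec-enc }
  where
    enc : Maybe A → Fin (suc (suc (bound F)))
    enc nothing  = zero
    enc (just a) = suc (encode F a)
    dec : Fin (suc (suc (bound F))) → Maybe A
    dec zero    = nothing
    dec (suc i) = just (decode F i)
    dec-enc : ∀ s → dec (enc s) ≡ s
    dec-enc nothing  = refl
    dec-enc (just a) = cong just (decode-encode F a)

finite-Bool : Finite Bool
finite-Bool = finite-retract (finite-Maybe finite-⊤) to from from-to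
  where
    to : Bool → Maybe ⊤
    to false = nothing
    to true  = just tt
    from : Maybe ⊤ → Bool
    from nothing  = false
    from (just _) = true
    from-to : ∀ b → from (to b) ≡ b
    from-to false = refl
    from-to true  = refl

finite-× : ∀ {A B} → Finite A → Finite B → Finite (A × B)
finite-× FA FB = record
  { bound = bound FB + bound FA * suc (bound FB)
  ; encode = λ { (a , b) → combine (encode FA a) (encode FB b) }
  ; decode = λ i → let (a , b) = remQuot (suc (bound FB)) i in decode FA a , decode FB b
  ; decode-encode = λ { (a , b) →
      trans (cong (λ r → decode FA (proj₁ r) , decode FB (proj₂ r))
                  (remQuot-combine (encode FA a) (encode FB b)))
            (cong₂ _,_ (decode-encode FA a) (decode-encode FB b)) } }

complement : ∀ {B} → DFA B → DFA B
complement D = record D { final = not ∘ DFA.final D }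

acceptsDFA-complement : ∀ {B} (D : DFA B) w → acceptsDFA (complement D) w ≡ not (acceptsDFA D w)
acceptsDFA-complement D w = cong (not ∘ DFA.final D) (same-run (DFA.start D) w)
  where
    same-run : ∀ q w → runDFA (complement D) q w ≡ runDFA D q w
    same-run q []       = refl
    same-run q (b ∷ bs) = same-run (DFA.δ D q b) bs

complement-rejects⇒accepts : ∀ {B} (D : DFA B) w → acceptsDFA (complement D) w ≡ false → acceptsDFA D w ≡ true
complement-rejects⇒accepts D w rej with acceptsDFA D w | acceptsDFA-complement D w
... | true | _ = refl
... | false | eq with () ← trans (sym eq) rej

rejects-complement : ∀ {B} (D : DFA B) w → acceptsDFA D w ≡ true → acceptsDFA (complement D) w ≡ false
rejects-complement D w acc = trans (acceptsDFA-complement D w) (cong not acc)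

-- A two-tape automaton reads two words in lockstep; it is compiled to a DFA over their
-- convolution, and a length mismatch leads to the absorbing state dead.
record TwoTapeAutomaton (A : Set) : Set₁ where
  field
    State        : Set
    finite       : Finite State
    start        : State
    step         : State → A → A → State
    dead         : State
    accepting    : State → Bool
    dead-step    : ∀ a b → step dead a b ≡ dead
    dead-rejects : accepting dead ≡ false

module TwoTape {A : Set} (M : TwoTapeAutomaton A) where
  open TwoTapeAutomaton M

  run : State → List A → List A → State
  run q []       []       = q
  run q (a ∷ as) (b ∷ bs) = run (step q a b) as bs
  run q []       (_ ∷ _)  = dead
  run q (_ ∷ _)  []       = dead

  Accepts : State → List A → List A → Set
  Accepts q as bs = accepting (run q as bs) ≡ true

  accepts : List A → List A → Bool
  accepts as bs = accepting (run start as bs)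

  toDFA : DFA (Vec (Maybe A) 2)
  toDFA = record
    { Q = bound finite ; start = encode finite start ; δ = δ
    ; final = accepting ∘ decode finite }
    where
      δ : Fin (suc (bound finite)) → Vec (Maybe A) 2 → Fin (suc (bound finite))
      δ q (just a  ∷ just b ∷ []) = encode finite (step (decode finite q) a b)
      δ q (just a  ∷ nothing ∷ []) = encode finite dead
      δ q (nothing ∷ _ ∷ [])      = encode finite dead

  run-dead : ∀ as bs → run dead as bs ≡ dead
  run-dead []       []       = refl
  run-dead (a ∷ as) (b ∷ bs) rewrite dead-step a b = run-dead as bs
  run-dead []       (_ ∷ _)  = refl
  run-dead (_ ∷ _)  []       = refl

  dead-no-accept : ∀ as bs → ¬ Accepts dead as bs
  dead-no-accept as bs acc
    with () ← trans (sym dead-rejects) (trans (cong accepting (sym (run-dead as bs))) acc)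

  private
    runPadded : ℕ → State → List A → List A → State
    runPadded zero    q as       bs       = q
    runPadded (suc m) q (a ∷ as) (b ∷ bs) = runPadded m (step q a b) as bs
    runPadded (suc m) q []       bs       = runPadded m dead [] (tailL bs)
    runPadded (suc m) q (a ∷ as) []       = runPadded m dead as []

    runPadded-dead : ∀ m as bs → runPadded m dead as bs ≡ dead
    runPadded-dead zero    as       bs       = refl
    runPadded-dead (suc m) (a ∷ as) (b ∷ bs) rewrite dead-step a b = runPadded-dead m as bs
    runPadded-dead (suc m) []       bs       = runPadded-dead m [] (tailL bs)
    runPadded-dead (suc m) (a ∷ as) []       = runPadded-dead m as []

    runDFA-convN : ∀ m q as bs →
      runDFA toDFA (encode finite q) (convN m (as ∷ bs ∷ [])) ≡ encode finite (runPadded m q as bs)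
    runDFA-convN zero    q as       bs       = refl
    runDFA-convN (suc m) q (a ∷ as) (b ∷ bs) rewrite decode-encode finite q = runDFA-convN m (step q a b) as bs
    runDFA-convN (suc m) q []       []       = runDFA-convN m dead [] []
    runDFA-convN (suc m) q []       (b ∷ bs) = runDFA-convN m dead [] bs
    runDFA-convN (suc m) q (a ∷ as) []       = runDFA-convN m dead as []

    runPadded-maxLen : ∀ q as bs → runPadded (length as ⊔ length bs) q as bs ≡ run q as bs
    runPadded-maxLen q []       []       = refl
    runPadded-maxLen q (a ∷ as) (b ∷ bs) = runPadded-maxLen (step q a b) as bs
    runPadded-maxLen q []       (b ∷ bs) = runPadded-dead (length bs) [] bs
    runPadded-maxLen q (a ∷ as) []       = runPadded-dead (length as) as []

  acceptsDFA-toDFA : ∀ as bs → acceptsDFA toDFA (conv (as ∷ bs ∷ [])) ≡ accepts as bs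
  acceptsDFA-toDFA as bs
    rewrite ⊔-identityʳ (length bs) | runDFA-convN (length as ⊔ length bs) start as bs
          | runPadded-maxLen start as bs = cong accepting (decode-encode finite (run start as bs))

  toDFA⇒accepts : ∀ as bs {b} → acceptsDFA toDFA (conv (as ∷ bs ∷ [])) ≡ b → accepts as bs ≡ b
  toDFA⇒accepts as bs eq = trans (sym (acceptsDFA-toDFA as bs)) eq

  accepts⇒toDFA : ∀ as bs {b} → accepts as bs ≡ b → acceptsDFA toDFA (conv (as ∷ bs ∷ [])) ≡ b
  accepts⇒toDFA as bs eq = trans (acceptsDFA-toDFA as bs) eq

  toDFAᶜ : DFA (Vec (Maybe A) 2)
  toDFAᶜ = complement toDFA

  toDFAᶜ⇒accepts : ∀ as bs → acceptsDFA toDFAᶜ (conv (as ∷ bs ∷ [])) ≡ false → accepts as bs ≡ true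
  toDFAᶜ⇒accepts as bs rej = toDFA⇒accepts as bs (complement-rejects⇒accepts toDFA (conv (as ∷ bs ∷ [])) rej)

  accepts⇒toDFAᶜ : ∀ as bs → accepts as bs ≡ true → acceptsDFA toDFAᶜ (conv (as ∷ bs ∷ [])) ≡ false
  accepts⇒toDFAᶜ as bs acc = rejects-complement toDFA (conv (as ∷ bs ∷ [])) (accepts⇒toDFA as bs acc)

  Accepts⇒equal-length : ∀ q as bs → Accepts q as bs → length as ≡ length bs
  Accepts⇒equal-length q []       []       _   = refl
  Accepts⇒equal-length q (a ∷ as) (b ∷ bs) acc = cong suc (Accepts⇒equal-length (step q a b) as bs acc)
  Accepts⇒equal-length q []       (_ ∷ _)  acc with () ← trans (sym dead-rejects) acc
  Accepts⇒equal-length q (_ ∷ _)  []       acc with () ← trans (sym dead-rejects) acc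

  run-++ : ∀ q as₁ as₂ bs₁ bs₂ → length as₁ ≡ length bs₁ →
           run q (as₁ ++ as₂) (bs₁ ++ bs₂) ≡ run (run q as₁ bs₁) as₂ bs₂
  run-++ q []        as₂ []        bs₂ _  = refl
  run-++ q (a ∷ as₁) as₂ (b ∷ bs₁) bs₂ eq = run-++ (step q a b) as₁ as₂ bs₁ bs₂ (suc-injective eq)

  toDFA-bounded : Bounded toDFA
  toDFA-bounded = 0 , λ { y (x ∷ []) acc → bounds y x (trans (sym (acceptsDFA-toDFA y x)) acc) }
    where
      bounds : ∀ y x → Accepts start y x → (length y ≤ maxLen (x ∷ []) + 0) × (maxLen (x ∷ []) ≤ length y + 0)
      bounds y x acc rewrite Accepts⇒equal-length start y x acc | ⊔-identityʳ (length x) | +-identityʳ (length x) =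
        ≤-refl , ≤-refl

-- The work alphabet and annotated encodings

Γ : Set
Γ = Sym ⊎ Fin 4

_=ᵇ_ : Bool → Bool → Bool
true  =ᵇ true  = true
false =ᵇ false = true
_     =ᵇ _     = false

=ᵇ⇒≡ : ∀ a b → a =ᵇ b ≡ true → a ≡ b
=ᵇ⇒≡ true  true  _ = refl
=ᵇ⇒≡ false false _ = refl

=ᵇ-refl : ∀ a → a =ᵇ a ≡ true
=ᵇ-refl true  = refl
=ᵇ-refl false = refl

digitSym : Bool → Γ
digitSym b = inj₁ (digit b)

-- The extra symbols are the signs of literals annotated with the guessed value of their
-- variable: signSym s v stands for + (s = true) or - (s = false) together with the value v.
signSym : Bool → Bool → Γ
signSym s v = inj₂ (code s v)
  where
    code : Bool → Bool → Fin 4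
    code true  true  = zero
    code true  false = suc zero
    code false true  = suc (suc zero)
    code false false = suc (suc (suc zero))

barSym ampSym : Γ
barSym = inj₁ bar
ampSym = inj₁ amp

data SymClass : Set where
  digitC : Bool → SymClass
  signC  : Bool → Bool → SymClass
  barC ampC otherC : SymClass

classify : Γ → SymClass
classify (inj₁ s0)    = digitC false
classify (inj₁ s1)    = digitC true
classify (inj₁ plus)  = otherC
classify (inj₁ minus) = otherC
classify (inj₁ bar)   = barC
classify (inj₁ amp)   = ampC
classify (inj₂ zero)                   = signC true true
classify (inj₂ (suc zero))             = signC true false
classify (inj₂ (suc (suc zero)))       = signC false true
classify (inj₂ (suc (suc (suc zero)))) = signC false false

fromClass : SymClass → Γ
fromClass (digitC b)  = digitSym b
fromClass (signC s v) = signSym s v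
fromClass barC        = barSym
fromClass ampC        = ampSym
fromClass otherC      = inj₁ plus

classify-digitSym : ∀ b → classify (digitSym b) ≡ digitC b
classify-digitSym false = refl
classify-digitSym true  = refl

classify-signSym : ∀ s v → classify (signSym s v) ≡ signC s v
classify-signSym true  true  = refl
classify-signSym true  false = refl
classify-signSym false true  = refl
classify-signSym false false = refl

classify⁻¹ : ∀ x {c} → classify x ≡ c → c ≢ otherC → x ≡ fromClass c
classify⁻¹ (inj₁ s0)    refl _ = refl
classify⁻¹ (inj₁ s1)    refl _ = refl
classify⁻¹ (inj₁ plus)  refl c≢ = ⊥-elim (c≢ refl)
classify⁻¹ (inj₁ minus) refl c≢ = ⊥-elim (c≢ refl)
classify⁻¹ (inj₁ bar)   refl _ = refl
classify⁻¹ (inj₁ amp)   refl _ = refl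
classify⁻¹ (inj₂ zero)                   refl _ = refl
classify⁻¹ (inj₂ (suc zero))             refl _ = refl
classify⁻¹ (inj₂ (suc (suc zero)))       refl _ = refl
classify⁻¹ (inj₂ (suc (suc (suc zero)))) refl _ = refl

-- An annotated literal: digits of the variable name, sign, guessed value of the variable.
ALit : Set
ALit = List Bool × Bool × Bool

AClause : Set
AClause = ALit × ALit × ALit

AFormula : Set
AFormula = List AClause

digitsOf : ALit → List Bool
digitsOf (ds , _ , _) = ds

valueOf : ALit → Bool
valueOf (_ , _ , v) = v

variableOf : ALit → ℕ
variableOf l = fromBits (digitsOf l)

alits : AFormula → List ALit
alits []                  = []
alits ((a , b , c) ∷ ρ) = a ∷ b ∷ c ∷ alits ρ

mapAF : (ALit → ALit) → AFormula → AFormula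
mapAF f []                = []
mapAF f ((a , b , c) ∷ ρ) = (f a , f b , f c) ∷ mapAF f ρ

encALit : ALit → List Γ → List Γ
encALit (ds , s , v) X = map digitSym ds ++ signSym s v ∷ X

encAClause : AClause → List Γ → List Γ
encAClause (a , b , c) X = encALit a (barSym ∷ encALit b (barSym ∷ encALit c X))

encAFormulaTail : AFormula → List Γ
encAFormulaTail []      = []
encAFormulaTail (c ∷ ρ) = ampSym ∷ encAClause c (encAFormulaTail ρ)

encAFormula : AFormula → List Γ
encAFormula []      = []
encAFormula (c ∷ ρ) = encAClause c (encAFormulaTail ρ)

-- Two annotated literals with the same sign and value, written one above the other.
LitPair : Set
LitPair = List Bool × List Bool × Bool × Bool

ClausePair : Set
ClausePair = LitPair × LitPair × LitPair

FormulaPair : Set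
FormulaPair = List ClausePair

leftLit rightLit : LitPair → ALit
leftLit  (ds , es , s , v) = ds , s , v
rightLit (ds , es , s , v) = es , s , v

leftDigits rightDigits : LitPair → List Bool
leftDigits  (ds , _ , _ , _) = ds
rightDigits (_ , es , _ , _) = es

leftC rightC : ClausePair → AClause
leftC  (a , b , c) = leftLit a , leftLit b , leftLit c
rightC (a , b , c) = rightLit a , rightLit b , rightLit c

leftF rightF : FormulaPair → AFormula
leftF  []                = []
leftF  ((a , b , c) ∷ π) = (leftLit a , leftLit b , leftLit c) ∷ leftF π
rightF []                = []
rightF ((a , b , c) ∷ π) = (rightLit a , rightLit b , rightLit c) ∷ rightF π

litPairs : FormulaPair → List LitPair
litPairs []                = []
litPairs ((a , b , c) ∷ π) = a ∷ b ∷ c ∷ litPairs π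

SameLength : LitPair → Set
SameLength (ds , es , _ , _) = length ds ≡ length es

SameLengths : FormulaPair → Set
SameLengths π = All SameLength (litPairs π)

liftAF : (ALit → LitPair) → AFormula → FormulaPair
liftAF f []                = []
liftAF f ((a , b , c) ∷ ρ) = (f a , f b , f c) ∷ liftAF f ρ

leftF-liftAF : ∀ f ρ → leftF (liftAF f ρ) ≡ mapAF (leftLit ∘ f) ρ
leftF-liftAF f []                = refl
leftF-liftAF f ((a , b , c) ∷ ρ) = cong (_ ∷_) (leftF-liftAF f ρ)

rightF-liftAF : ∀ f ρ → rightF (liftAF f ρ) ≡ mapAF (rightLit ∘ f) ρ
rightF-liftAF f []                = refl
rightF-liftAF f ((a , b , c) ∷ ρ) = cong (_ ∷_) (rightF-liftAF f ρ)

litPairs-liftAF : ∀ f ρ → litPairs (liftAF f ρ) ≡ map f (alits ρ)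
litPairs-liftAF f []                = refl
litPairs-liftAF f ((a , b , c) ∷ ρ) = cong (λ t → f a ∷ f b ∷ f c ∷ t) (litPairs-liftAF f ρ)

alits-mapAF : ∀ f ρ → alits (mapAF f ρ) ≡ map f (alits ρ)
alits-mapAF f []                = refl
alits-mapAF f ((a , b , c) ∷ ρ) = cong (λ t → f a ∷ f b ∷ f c ∷ t) (alits-mapAF f ρ)

mapAF-id : ∀ ρ → mapAF (λ l → l) ρ ≡ ρ
mapAF-id []      = refl
mapAF-id (c ∷ ρ) = cong (c ∷_) (mapAF-id ρ)

sameLengths-liftAF : ∀ f → (∀ l → SameLength (f l)) → ∀ ρ → SameLengths (liftAF f ρ)
sameLengths-liftAF f h []                = []
sameLengths-liftAF f h ((a , b , c) ∷ ρ) = h a ∷ h b ∷ h c ∷ sameLengths-liftAF f h ρ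

-- Literalwise automata compare two encodings of the same shape literal by literal: a local
-- state scans the digit columns of a literal pair, and its final value updates a global state.
record LiteralwiseAutomaton : Set₁ where
  field
    Global Local  : Set
    finiteGlobal  : Finite Global
    finiteLocal   : Finite Local
    global₀       : Global
    local₀        : Local
    digitStep     : Local → Bool → Bool → Maybe Local
    signStep      : Global → Local → Bool → Bool → Maybe Global
    acceptsGlobal : Global → Bool

module Literalwise (B : LiteralwiseAutomaton) where
  open LiteralwiseAutomaton B

  St : Set
  St = Maybe (Global × Local)

  withGlobal : Global → Maybe Local → St
  withGlobal g nothing  = nothing
  withGlobal g (just l) = just (g , l)

  enterLit : Maybe Global → St
  enterLit nothing  = nothing
  enterLit (just g) = just (g , local₀)

  stepClass : Global → Local → SymClass → SymClass → St
  stepClass g l (digitC a)  (digitC b)    = withGlobal g (digitStep l a b)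
  stepClass g l (signC s v) (signC s′ v′) = if (s =ᵇ s′) ∧ (v =ᵇ v′) then enterLit (signStep g l s v) else nothing
  stepClass g l barC        barC          = just (g , l)
  stepClass g l ampC        ampC          = just (g , l)
  stepClass g l _           _             = nothing

  stepSym : St → Γ → Γ → St
  stepSym nothing        _ _ = nothing
  stepSym (just (g , l)) x y = stepClass g l (classify x) (classify y)

  acceptsSt : St → Bool
  acceptsSt nothing        = false
  acceptsSt (just (g , _)) = acceptsGlobal g

  automaton : TwoTapeAutomaton Γ
  automaton = record
    { State = St ; finite = finite-Maybe (finite-× finiteGlobal finiteLocal) ; start = just (global₀ , local₀)
    ; step = stepSym ; dead = nothing ; accepting = acceptsSt
    ; dead-step = λ _ _ → refl ; dead-rejects = refl }

  open TwoTape automaton public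

  digitSteps : Maybe Local → List Bool → List Bool → Maybe Local
  digitSteps nothing  _        _        = nothing
  digitSteps (just l) []       []       = just l
  digitSteps (just l) (a ∷ as) (b ∷ bs) = digitSteps (digitStep l a b) as bs
  digitSteps (just l) []       (_ ∷ _)  = nothing
  digitSteps (just l) (_ ∷ _)  []       = nothing

  litStep : Maybe Global → LitPair → Maybe Global
  litStep nothing  _                 = nothing
  litStep (just g) (ds , es , s , v) with digitSteps (just local₀) ds es
  ... | nothing = nothing
  ... | just l  = signStep g l s v

  foldLits : Maybe Global → List LitPair → Maybe Global
  foldLits m []       = m
  foldLits m (p ∷ ps) = foldLits (litStep m p) ps

  foldLits-nothing : ∀ ps → foldLits nothing ps ≡ nothing
  foldLits-nothing []       = refl
  foldLits-nothing (p ∷ ps) = foldLits-nothing ps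

  acceptsResult : Maybe Global → Bool
  acceptsResult nothing  = false
  acceptsResult (just g) = acceptsGlobal g

  private
    run-nothing : ∀ X₁ X₂ Y₁ Y₂ → run nothing X₁ Y₁ ≡ run nothing X₂ Y₂
    run-nothing X₁ X₂ Y₁ Y₂ = trans (run-dead X₁ Y₁) (sym (run-dead X₂ Y₂))

    run-digits : ∀ g m ds es X Y → length ds ≡ length es →
      run (withGlobal g m) (map digitSym ds ++ X) (map digitSym es ++ Y) ≡ run (withGlobal g (digitSteps m ds es)) X Y
    run-digits g nothing  ds       es       X Y _  = run-nothing (map digitSym ds ++ X) X (map digitSym es ++ Y) Y
    run-digits g (just l) []       []       X Y _  = refl
    run-digits g (just l) (d ∷ ds) (e ∷ es) X Y eq rewrite classify-digitSym d | classify-digitSym e =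
      run-digits g (digitStep l d e) ds es X Y (suc-injective eq)

    run-lit : ∀ m p X Y → SameLength p →
      run (enterLit m) (encALit (leftLit p) X) (encALit (rightLit p) Y) ≡ run (enterLit (litStep m p)) X Y
    run-lit nothing  p                 X Y _  = run-nothing (encALit (leftLit p) X) X (encALit (rightLit p) Y) Y
    run-lit (just g) (ds , es , s , v) X Y eq
      rewrite run-digits g (just local₀) ds es (signSym s v ∷ X) (signSym s v ∷ Y) eq
      with digitSteps (just local₀) ds es
    ... | nothing = refl
    ... | just l rewrite classify-signSym s v | =ᵇ-refl s | =ᵇ-refl v = refl

    run-separator : ∀ m x X Y → x ≡ barSym ⊎ x ≡ ampSym →
      run (enterLit m) (x ∷ X) (x ∷ Y) ≡ run (enterLit m) X Y
    run-separator nothing  x X Y _ = run-nothing (x ∷ X) X (x ∷ Y) Y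
    run-separator (just g) x X Y (inj₁ refl) = refl
    run-separator (just g) x X Y (inj₂ refl) = refl

    run-clause : ∀ m a b c X Y → SameLength a → SameLength b → SameLength c →
      run (enterLit m) (encAClause (leftLit a , leftLit b , leftLit c) X) (encAClause (rightLit a , rightLit b , rightLit c) Y)
        ≡ run (enterLit (litStep (litStep (litStep m a) b) c)) X Y
    run-clause m a b c X Y ea eb ec = begin
        run (enterLit m) (encALit (leftLit a) (barSym ∷ Xb)) (encALit (rightLit a) (barSym ∷ Yb))
      ≡⟨ run-lit m a _ _ ea ⟩
        run (enterLit (litStep m a)) (barSym ∷ Xb) (barSym ∷ Yb)
      ≡⟨ run-separator (litStep m a) barSym Xb Yb (inj₁ refl) ⟩
        run (enterLit (litStep m a)) (encALit (leftLit b) (barSym ∷ Xc)) (encALit (rightLit b) (barSym ∷ Yc))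
      ≡⟨ run-lit (litStep m a) b _ _ eb ⟩
        run (enterLit (litStep (litStep m a) b)) (barSym ∷ Xc) (barSym ∷ Yc)
      ≡⟨ run-separator (litStep (litStep m a) b) barSym Xc Yc (inj₁ refl) ⟩
        run (enterLit (litStep (litStep m a) b)) Xc Yc
      ≡⟨ run-lit (litStep (litStep m a) b) c X Y ec ⟩
        run (enterLit (litStep (litStep (litStep m a) b) c)) X Y
      ∎
      where
        open ≡-Reasoning
        Xc = encALit (leftLit c) X
        Yc = encALit (rightLit c) Y
        Xb = encALit (leftLit b) (barSym ∷ Xc)
        Yb = encALit (rightLit b) (barSym ∷ Yc)

    run-tail : ∀ m π → SameLengths π →
      run (enterLit m) (encAFormulaTail (leftF π)) (encAFormulaTail (rightF π)) ≡ enterLit (foldLits m (litPairs π))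
    run-tail m []                _                       = refl
    run-tail m ((a , b , c) ∷ π) (ea ∷ eb ∷ ec ∷ es) =
      trans (run-separator m ampSym (encAClause (leftLit a , leftLit b , leftLit c) X)
                                          (encAClause (rightLit a , rightLit b , rightLit c) Y) (inj₂ refl))
            (trans (run-clause m a b c X Y ea eb ec) (run-tail (litStep (litStep (litStep m a) b) c) π es))
      where
        X = encAFormulaTail (leftF π)
        Y = encAFormulaTail (rightF π)

    run-encAFormula : ∀ π → SameLengths π →
      run (enterLit (just global₀)) (encAFormula (leftF π)) (encAFormula (rightF π))
        ≡ enterLit (foldLits (just global₀) (litPairs π))
    run-encAFormula []                _                   = refl
    run-encAFormula ((a , b , c) ∷ π) (ea ∷ eb ∷ ec ∷ es) =
      trans (run-clause (just global₀) a b c (encAFormulaTail (leftF π)) (encAFormulaTail (rightF π)) ea eb ec)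
            (run-tail (litStep (litStep (litStep (just global₀) a) b) c) π es)

    acceptsSt-enterLit : ∀ m → acceptsSt (enterLit m) ≡ acceptsResult m
    acceptsSt-enterLit nothing  = refl
    acceptsSt-enterLit (just g) = refl

  accepting-encAFormula : ∀ π {ρ σ} → leftF π ≡ ρ → rightF π ≡ σ → SameLengths π →
    accepts (encAFormula ρ) (encAFormula σ) ≡ acceptsResult (foldLits (just global₀) (litPairs π))
  accepting-encAFormula π refl refl eqs =
    trans (cong acceptsSt (run-encAFormula π eqs)) (acceptsSt-enterLit (foldLits (just global₀) (litPairs π)))

  private
    Accepts-nil⇒nil : ∀ q a → Accepts q a [] → a ≡ []
    Accepts-nil⇒nil q []      _ = refl
    Accepts-nil⇒nil q (x ∷ a) ()

    parse-digits : ∀ q es a Y → Accepts q a (map digitSym es ++ Y) →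
      Σ (List Bool) λ ds → Σ (List Γ) λ X → (a ≡ map digitSym ds ++ X) × (length ds ≡ length es)
    parse-digits q              []       a       Y _   = [] , a , refl , refl
    parse-digits nothing        (e ∷ es) a       Y acc = ⊥-elim (dead-no-accept a _ acc)
    parse-digits (just (g , l)) (e ∷ es) []      Y ()
    parse-digits (just (g , l)) (e ∷ es) (x ∷ a) Y acc rewrite classify-digitSym e with classify x in eq
    ... | digitC d with parse-digits (withGlobal g (digitStep l d e)) es a Y acc
    ...   | ds , X , refl , ≡len = d ∷ ds , X , cong (_∷ _) (classify⁻¹ x eq λ ()) , cong suc ≡len
    parse-digits (just (g , l)) (e ∷ es) (x ∷ a) Y acc | signC _ _ = ⊥-elim (dead-no-accept a _ acc)
    parse-digits (just (g , l)) (e ∷ es) (x ∷ a) Y acc | barC      = ⊥-elim (dead-no-accept a _ acc)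
    parse-digits (just (g , l)) (e ∷ es) (x ∷ a) Y acc | ampC      = ⊥-elim (dead-no-accept a _ acc)
    parse-digits (just (g , l)) (e ∷ es) (x ∷ a) Y acc | otherC    = ⊥-elim (dead-no-accept a _ acc)

    both-true : ∀ b₁ b₂ (t : St) a b → Accepts (if b₁ ∧ b₂ then t else nothing) a b → (b₁ ≡ true) × (b₂ ≡ true)
    both-true true  true  t a b _   = refl , refl
    both-true true  false t a b acc = ⊥-elim (dead-no-accept a b acc)
    both-true false _     t a b acc = ⊥-elim (dead-no-accept a b acc)

    parse-sign : ∀ q s v Y a → Accepts q a (signSym s v ∷ Y) → Σ (List Γ) λ X → a ≡ signSym s v ∷ X
    parse-sign nothing        s v Y a       acc = ⊥-elim (dead-no-accept a _ acc)
    parse-sign (just _)       s v Y []      ()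
    parse-sign (just (g , l)) s v Y (x ∷ a) acc rewrite classify-signSym s v with classify x in eq
    ... | signC s′ v′ with both-true (s′ =ᵇ s) (v′ =ᵇ v) _ a Y acc
    ...   | s′≡s , v′≡v rewrite =ᵇ⇒≡ s′ s s′≡s | =ᵇ⇒≡ v′ v v′≡v = a , cong (_∷ a) (classify⁻¹ x eq λ ())
    parse-sign (just (g , l)) s v Y (x ∷ a) acc | digitC _ = ⊥-elim (dead-no-accept a _ acc)
    parse-sign (just (g , l)) s v Y (x ∷ a) acc | barC     = ⊥-elim (dead-no-accept a _ acc)
    parse-sign (just (g , l)) s v Y (x ∷ a) acc | ampC     = ⊥-elim (dead-no-accept a _ acc)
    parse-sign (just (g , l)) s v Y (x ∷ a) acc | otherC   = ⊥-elim (dead-no-accept a _ acc)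

    parse-bar : ∀ q Y a → Accepts q a (barSym ∷ Y) →
      Σ (List Γ) λ X → (a ≡ barSym ∷ X) × Accepts (stepSym q barSym barSym) X Y
    parse-bar nothing        Y a       acc = ⊥-elim (dead-no-accept a _ acc)
    parse-bar (just _)       Y []      ()
    parse-bar (just (g , l)) Y (x ∷ a) acc with classify x in eq
    ... | barC      = a , cong (_∷ a) (classify⁻¹ x eq λ ()) , acc
    ... | digitC _  = ⊥-elim (dead-no-accept a _ acc)
    ... | signC _ _ = ⊥-elim (dead-no-accept a _ acc)
    ... | ampC      = ⊥-elim (dead-no-accept a _ acc)
    ... | otherC    = ⊥-elim (dead-no-accept a _ acc)

    parse-amp : ∀ q Y a → Accepts q a (ampSym ∷ Y) →
      Σ (List Γ) λ X → (a ≡ ampSym ∷ X) × Accepts (stepSym q ampSym ampSym) X Y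
    parse-amp nothing        Y a       acc = ⊥-elim (dead-no-accept a _ acc)
    parse-amp (just _)       Y []      ()
    parse-amp (just (g , l)) Y (x ∷ a) acc with classify x in eq
    ... | ampC      = a , cong (_∷ a) (classify⁻¹ x eq λ ()) , acc
    ... | digitC _  = ⊥-elim (dead-no-accept a _ acc)
    ... | signC _ _ = ⊥-elim (dead-no-accept a _ acc)
    ... | barC      = ⊥-elim (dead-no-accept a _ acc)
    ... | otherC    = ⊥-elim (dead-no-accept a _ acc)

    record LitParse (q : St) (a : List Γ) (l : ALit) (Y : List Γ) : Set where
      constructor litParse
      field
        pair       : LitPair
        rest       : List Γ
        next       : St
        right≡     : rightLit pair ≡ l
        sameLength : SameLength pair
        a≡         : a ≡ encALit (leftLit pair) rest
        accepts′   : Accepts next rest Y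

    parse-lit : ∀ q a l Y → Accepts q a (encALit l Y) → LitParse q a l Y
    parse-lit q a (es , s , v) Y acc with parse-digits q es a (signSym s v ∷ Y) acc
    ... | ds , X , refl , ≡len
      with parse-sign (run q (map digitSym ds) (map digitSym es)) s v Y X
             (subst (λ t → acceptsSt t ≡ true) (run-++ q (map digitSym ds) X (map digitSym es) _ ≡len′) acc)
      where ≡len′ = trans (length-map digitSym ds) (trans ≡len (sym (length-map digitSym es)))
    ... | X′ , refl = litParse (ds , es , s , v) X′ _ refl ≡len refl
      (subst (λ t → acceptsSt t ≡ true) (run-++ q (map digitSym ds) (signSym s v ∷ X′) (map digitSym es) _ ≡len′) acc)
      where ≡len′ = trans (length-map digitSym ds) (trans ≡len (sym (length-map digitSym es)))

    record ClauseParse (a : List Γ) (c : AClause) (Y : List Γ) : Set where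
      constructor clauseParse
      field
        pairs       : ClausePair
        rest        : List Γ
        next        : St
        right≡      : rightC pairs ≡ c
        sameLengths : SameLength (proj₁ pairs) × SameLength (proj₁ (proj₂ pairs)) × SameLength (proj₂ (proj₂ pairs))
        a≡          : a ≡ encAClause (leftC pairs) rest
        accepts′    : Accepts next rest Y

    parse-clause : ∀ q a c Y → Accepts q a (encAClause c Y) → ClauseParse a c Y
    parse-clause q a (l₁ , l₂ , l₃) Y acc
      with parse-lit q a l₁ _ acc
    ... | litParse p₁ X₁ q₁ r₁ e₁ refl acc₁ with parse-bar q₁ _ X₁ acc₁
    ... | X₂ , refl , acc₂ with parse-lit (stepSym q₁ barSym barSym) X₂ l₂ _ acc₂
    ... | litParse p₂ X₃ q₃ r₂ e₂ refl acc₃ with parse-bar q₃ _ X₃ acc₃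
    ... | X₄ , refl , acc₄ with parse-lit (stepSym q₃ barSym barSym) X₄ l₃ Y acc₄
    ... | litParse p₃ X₅ q₅ r₃ e₃ refl acc₅ =
      clauseParse (p₁ , p₂ , p₃) X₅ q₅ (cong₂ _,_ r₁ (cong₂ _,_ r₂ r₃)) (e₁ , e₂ , e₃) refl acc₅

    parse-tail : ∀ σ q a → Accepts q a (encAFormulaTail σ) →
      Σ FormulaPair λ π → (rightF π ≡ σ) × SameLengths π × (a ≡ encAFormulaTail (leftF π))
    parse-tail []      q a acc = [] , refl , [] , Accepts-nil⇒nil q a acc
    parse-tail (c ∷ σ) q a acc with parse-amp q _ a acc
    ... | X₁ , refl , acc₁ with parse-clause (stepSym q ampSym ampSym) X₁ c _ acc₁
    ... | clauseParse ps X₂ q₂ r (e₁ , e₂ , e₃) refl acc₂ with parse-tail σ q₂ X₂ acc₂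
    ... | π , refl , es , refl = ps ∷ π , cong (_∷ rightF π) r , e₁ ∷ e₂ ∷ e₃ ∷ es , refl

  parse-encAFormula : ∀ σ a → Accepts (just (global₀ , local₀)) a (encAFormula σ) →
    Σ FormulaPair λ π → (rightF π ≡ σ) × SameLengths π × (a ≡ encAFormula (leftF π))
  parse-encAFormula []      a acc = [] , refl , [] , Accepts-nil⇒nil _ a acc
  parse-encAFormula (c ∷ σ) a acc with parse-clause _ a c _ acc
  ... | clauseParse ps X₂ q₂ r (e₁ , e₂ , e₃) refl acc₂ with parse-tail σ q₂ X₂ acc₂
  ... | π , refl , es , refl = ps ∷ π , cong (_∷ rightF π) r , e₁ ∷ e₂ ∷ e₃ ∷ es , refl

pointwise : ∀ {A : Set} → (A → A → Bool) → TwoTapeAutomaton A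
pointwise P = record
  { State = Bool ; finite = finite-Bool ; start = true
  ; step = λ { true x y → P x y ; false _ _ → false }
  ; dead = false ; accepting = λ b → b
  ; dead-step = λ _ _ → refl ; dead-rejects = refl }

module PointwiseAutomaton {A : Set} (P : A → A → Bool) where
  open TwoTape (pointwise P) public

  accepts⇒Pointwise : ∀ as bs → accepts as bs ≡ true → Pointwise (λ x y → P x y ≡ true) as bs
  accepts⇒Pointwise []       []       _   = []
  accepts⇒Pointwise (x ∷ as) (y ∷ bs) acc with P x y in eq
  ... | true  = eq ∷ accepts⇒Pointwise as bs acc
  ... | false with () ← trans (sym (run-dead as bs)) acc

  Pointwise⇒accepts : ∀ {as bs} → Pointwise (λ x y → P x y ≡ true) as bs → accepts as bs ≡ true
  Pointwise⇒accepts []                 = refl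
  Pointwise⇒accepts (_∷_ {x} {y} p ps) rewrite p = Pointwise⇒accepts ps

does⇒ : ∀ {X : Set} (x? : Dec X) → does x? ≡ true → X
does⇒ (yes x) _ = x

module Graph {A : Set} (_≟_ : DecidableEquality A) (f : A → A) where

  module Right = PointwiseAutomaton (λ x y → does (f x ≟ y))
  module Left  = PointwiseAutomaton (λ x y → does (x ≟ f y))

  accepts-right-sound : ∀ as bs → Right.accepts as bs ≡ true → bs ≡ map f as
  accepts-right-sound as bs acc = go (Right.accepts⇒Pointwise as bs acc)
    where
      go : ∀ {as bs} → Pointwise _ as bs → bs ≡ map f as
      go []       = refl
      go (p ∷ ps) = cong₂ _∷_ (sym (does⇒ (f _ ≟ _) p)) (go ps)

  accepts-right-complete : ∀ as → Right.accepts as (map f as) ≡ true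
  accepts-right-complete as = Right.Pointwise⇒accepts (go as)
    where
      go : ∀ as → Pointwise _ as (map f as)
      go []       = []
      go (x ∷ as) = dec-true (f x ≟ f x) refl ∷ go as

  accepts-left-sound : ∀ as bs → Left.accepts as bs ≡ true → as ≡ map f bs
  accepts-left-sound as bs acc = go (Left.accepts⇒Pointwise as bs acc)
    where
      go : ∀ {as bs} → Pointwise _ as bs → as ≡ map f bs
      go []       = refl
      go (p ∷ ps) = cong₂ _∷_ (does⇒ (_ ≟ f _) p) (go ps)

  accepts-left-complete : ∀ bs → Left.accepts (map f bs) bs ≡ true
  accepts-left-complete bs = Left.Pointwise⇒accepts (go bs)
    where
      go : ∀ bs → Pointwise _ (map f bs) bs
      go []       = []
      go (y ∷ bs) = dec-true (f y ≟ f y) refl ∷ go bs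

module Emptiness {A : Set} = PointwiseAutomaton {A} (λ _ _ → false)

emptiness-accepts⇒[] : ∀ {A : Set} (as bs : List A) → Emptiness.accepts as bs ≡ true → as ≡ []
emptiness-accepts⇒[] as bs acc with Emptiness.accepts⇒Pointwise as bs acc
... | [] = refl

emptiness-rejects-∷ : ∀ {A : Set} (x : A) as → Emptiness.accepts (x ∷ as) (x ∷ as) ≡ false
emptiness-rejects-∷ x as = Emptiness.run-dead as as

_≟Γ_ : DecidableEquality Γ
_≟Γ_ = ≡-dec _≟Sym_ Data.Fin._≟_
  where
    code : Sym → Fin 6
    code s0    = zero
    code s1    = suc zero
    code plus  = suc (suc zero)
    code minus = suc (suc (suc zero))
    code bar   = suc (suc (suc (suc zero)))
    code amp   = suc (suc (suc (suc (suc zero))))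
    uncode : Fin 6 → Sym
    uncode zero                                = s0
    uncode (suc zero)                          = s1
    uncode (suc (suc zero))                    = plus
    uncode (suc (suc (suc zero)))              = minus
    uncode (suc (suc (suc (suc zero))))        = bar
    uncode (suc (suc (suc (suc (suc zero)))))  = amp
    uncode-code : ∀ s → uncode (code s) ≡ s
    uncode-code s0    = refl
    uncode-code s1    = refl
    uncode-code plus  = refl
    uncode-code minus = refl
    uncode-code bar   = refl
    uncode-code amp   = refl
    _≟Sym_ : DecidableEquality Sym
    s ≟Sym t = map′ (λ eq → trans (sym (uncode-code s)) (trans (cong uncode eq) (uncode-code t)))
                    (cong code) (code s Data.Fin.≟ code t)

-- The syntax check

data Phase : Set where
  litStart inDigits afterLit : Phase

data Slot : Set where
  first second third : Slot

finite-Phase : Finite Phase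
finite-Phase = finite-retract (finite-Maybe finite-Bool) to from from-to
  where
    to : Phase → Maybe Bool
    to litStart = nothing
    to inDigits = just false
    to afterLit = just true
    from : Maybe Bool → Phase
    from nothing      = litStart
    from (just false) = inDigits
    from (just true)  = afterLit
    from-to : ∀ s → from (to s) ≡ s
    from-to litStart = refl
    from-to inDigits = refl
    from-to afterLit = refl

finite-Slot : Finite Slot
finite-Slot = finite-retract (finite-Maybe finite-Bool) to from from-to
  where
    to : Slot → Maybe Bool
    to first  = nothing
    to second = just false
    to third  = just true
    from : Maybe Bool → Slot
    from nothing      = first
    from (just false) = second
    from (just true)  = third
    from-to : ∀ s → from (to s) ≡ s
    from-to first  = refl
    from-to second = refl
    from-to third  = refl

annotatedTrue : ALit → Bool
annotatedTrue (_ , s , v) = s =ᵇ v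

NonzeroName : ALit → Set
NonzeroName l = or (digitsOf l) ≡ true

WellFormed : AClause → Set
WellFormed (a , b , c) = NonzeroName a × NonzeroName b × NonzeroName c
                       × (annotatedTrue a ∨ annotatedTrue b) ∨ annotatedTrue c ≡ true

-- State: phase, slot of the literal in its clause, whether the clause is satisfied so far,
-- and whether a nonzero digit has been read in the current variable name.
SyntaxState : Set
SyntaxState = Maybe (Phase × Slot × Bool × Bool)

afterSign : Slot → Bool → SyntaxState
afterSign first  sat = just (afterLit , first , sat , false)
afterSign second sat = just (afterLit , second , sat , false)
afterSign third  sat = if sat then just (afterLit , third , true , false) else nothing

syntaxStep : Phase × Slot × Bool × Bool → SymClass → SyntaxState
syntaxStep (litStart , p , sat , _)  (digitC d)  = just (inDigits , p , sat , d)
syntaxStep (inDigits , p , sat , nz) (digitC d)  = just (inDigits , p , sat , nz ∨ d)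
syntaxStep (inDigits , p , sat , nz) (signC s v) = if nz then afterSign p (sat ∨ (s =ᵇ v)) else nothing
syntaxStep (afterLit , first , sat , _)  barC    = just (litStart , second , sat , false)
syntaxStep (afterLit , second , sat , _) barC    = just (litStart , third , sat , false)
syntaxStep (afterLit , third , _ , _)    ampC    = just (litStart , first , false , false)
syntaxStep _ _ = nothing

syntaxAccepting : SyntaxState → Bool
syntaxAccepting (just (afterLit , third , _ , _)) = true
syntaxAccepting _                                 = false

syntaxStart : SyntaxState
syntaxStart = just (litStart , first , false , false)

clauseDone : SyntaxState
clauseDone = just (afterLit , third , true , false)

syntaxAutomaton : TwoTapeAutomaton Γ
syntaxAutomaton = record
  { State = SyntaxState
  ; finite = finite-Maybe (finite-× finite-Phase (finite-× finite-Slot (finite-× finite-Bool finite-Bool)))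
  ; start = syntaxStart
  ; step = λ { nothing _ _ → nothing ; (just st) x _ → syntaxStep st (classify x) }
  ; dead = nothing ; accepting = syntaxAccepting
  ; dead-step = λ _ _ → refl ; dead-rejects = refl }

module Syntax = TwoTape syntaxAutomaton
open Syntax using () renaming (run to runSyntax; Accepts to AcceptsSyntax)

private
  runSyntax-digits : ∀ p sat nz ds X →
    runSyntax (just (inDigits , p , sat , nz)) (map digitSym ds ++ X) (map digitSym ds ++ X)
      ≡ runSyntax (just (inDigits , p , sat , nz ∨ or ds)) X X
  runSyntax-digits p sat nz []       X rewrite ∨-identityʳ nz = refl
  runSyntax-digits p sat nz (d ∷ ds) X
    rewrite classify-digitSym d | runSyntax-digits p sat (nz ∨ d) ds X | ∨-assoc nz d (or ds) = refl

  runSyntax-lit : ∀ p sat l X → NonzeroName l →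
    runSyntax (just (litStart , p , sat , false)) (encALit l X) (encALit l X) ≡ runSyntax (afterSign p (sat ∨ annotatedTrue l)) X X
  runSyntax-lit p sat (d ∷ ds , s , v) X nz
    rewrite classify-digitSym d | runSyntax-digits p sat d ds (signSym s v ∷ X) | nz | classify-signSym s v = refl

  runSyntax-clause : ∀ c X → WellFormed c → runSyntax syntaxStart (encAClause c X) (encAClause c X) ≡ runSyntax clauseDone X X
  runSyntax-clause (a , b , c) X (nz-a , nz-b , nz-c , sat)
    rewrite runSyntax-lit first false a (barSym ∷ encALit b (barSym ∷ encALit c X)) nz-a
          | runSyntax-lit second (annotatedTrue a) b (barSym ∷ encALit c X) nz-b
          | runSyntax-lit third (annotatedTrue a ∨ annotatedTrue b) c X nz-c
          | sat = refl

  runSyntax-tail : ∀ ρ → All WellFormed ρ → AcceptsSyntax clauseDone (encAFormulaTail ρ) (encAFormulaTail ρ)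
  runSyntax-tail []      []       = refl
  runSyntax-tail (c ∷ ρ) (w ∷ ws) rewrite runSyntax-clause c (encAFormulaTail ρ) w = runSyntax-tail ρ ws

syntax-complete : ∀ c ρ → All WellFormed (c ∷ ρ) → Syntax.accepts (encAFormula (c ∷ ρ)) (encAFormula (c ∷ ρ)) ≡ true
syntax-complete c ρ (w ∷ ws) rewrite runSyntax-clause c (encAFormulaTail ρ) w = runSyntax-tail ρ ws

private
  dead-syntax : ∀ a → ¬ AcceptsSyntax nothing a a
  dead-syntax a = Syntax.dead-no-accept a a

  record DigitsParse (p : Slot) (sat nz : Bool) (a : List Γ) : Set where
    constructor digitsParse
    field
      ds    : List Bool
      s v   : Bool
      rest  : List Γ
      a≡    : a ≡ map digitSym ds ++ signSym s v ∷ rest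
      nz′   : nz ∨ or ds ≡ true
      accepted : AcceptsSyntax (afterSign p (sat ∨ (s =ᵇ v))) rest rest

  if-true : ∀ b (t : SyntaxState) a → AcceptsSyntax (if b then t else nothing) a a → b ≡ true
  if-true true  t a _   = refl
  if-true false t a acc = ⊥-elim (dead-syntax a acc)

  parse-digits : ∀ p sat nz a → AcceptsSyntax (just (inDigits , p , sat , nz)) a a → DigitsParse p sat nz a
  parse-digits p sat nz []      ()
  parse-digits p sat nz (x ∷ a) acc with classify x in eq
  ... | digitC d with parse-digits p sat (nz ∨ d) a acc
  ...   | digitsParse ds s v X refl nz′ acc′ =
          digitsParse (d ∷ ds) s v X (cong (_∷ _) (classify⁻¹ x eq λ ())) (trans (sym (∨-assoc nz d (or ds))) nz′) acc′
  parse-digits p sat nz (x ∷ a) acc | signC s v with if-true nz (afterSign p (sat ∨ (s =ᵇ v))) a acc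
  ... | refl = digitsParse [] s v a (cong (_∷ a) (classify⁻¹ x eq λ ())) refl acc
  parse-digits p sat nz (x ∷ a) acc | barC   = ⊥-elim (dead-syntax a acc)
  parse-digits p sat nz (x ∷ a) acc | ampC   = ⊥-elim (dead-syntax a acc)
  parse-digits p sat nz (x ∷ a) acc | otherC = ⊥-elim (dead-syntax a acc)

  record LitParse (p : Slot) (sat : Bool) (a : List Γ) : Set where
    constructor litParse
    field
      lit      : ALit
      rest     : List Γ
      a≡       : a ≡ encALit lit rest
      nonzero  : NonzeroName lit
      accepted : AcceptsSyntax (afterSign p (sat ∨ annotatedTrue lit)) rest rest

  parse-lit : ∀ p sat a → AcceptsSyntax (just (litStart , p , sat , false)) a a → LitParse p sat a
  parse-lit p sat []      ()
  parse-lit p sat (x ∷ a) acc with classify x in eq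
  ... | digitC d with parse-digits p sat d a acc
  ...   | digitsParse ds s v X refl nz acc′ = litParse (d ∷ ds , s , v) X (cong (_∷ _) (classify⁻¹ x eq λ ())) nz acc′
  parse-lit p sat (x ∷ a) acc | signC _ _ = ⊥-elim (dead-syntax a acc)
  parse-lit p sat (x ∷ a) acc | barC      = ⊥-elim (dead-syntax a acc)
  parse-lit p sat (x ∷ a) acc | ampC      = ⊥-elim (dead-syntax a acc)
  parse-lit p sat (x ∷ a) acc | otherC    = ⊥-elim (dead-syntax a acc)

  parse-bar₁ : ∀ sat a → AcceptsSyntax (just (afterLit , first , sat , false)) a a →
    Σ (List Γ) λ X → (a ≡ barSym ∷ X) × AcceptsSyntax (just (litStart , second , sat , false)) X X
  parse-bar₁ sat []      ()
  parse-bar₁ sat (x ∷ a) acc with classify x in eq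
  ... | barC      = a , cong (_∷ a) (classify⁻¹ x eq λ ()) , acc
  ... | digitC _  = ⊥-elim (dead-syntax a acc)
  ... | signC _ _ = ⊥-elim (dead-syntax a acc)
  ... | ampC      = ⊥-elim (dead-syntax a acc)
  ... | otherC    = ⊥-elim (dead-syntax a acc)

  parse-bar₂ : ∀ sat a → AcceptsSyntax (just (afterLit , second , sat , false)) a a →
    Σ (List Γ) λ X → (a ≡ barSym ∷ X) × AcceptsSyntax (just (litStart , third , sat , false)) X X
  parse-bar₂ sat []      ()
  parse-bar₂ sat (x ∷ a) acc with classify x in eq
  ... | barC      = a , cong (_∷ a) (classify⁻¹ x eq λ ()) , acc
  ... | digitC _  = ⊥-elim (dead-syntax a acc)
  ... | signC _ _ = ⊥-elim (dead-syntax a acc)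
  ... | ampC      = ⊥-elim (dead-syntax a acc)
  ... | otherC    = ⊥-elim (dead-syntax a acc)

  parse-end : ∀ a → AcceptsSyntax clauseDone a a →
    (a ≡ []) ⊎ (Σ (List Γ) λ X → (a ≡ ampSym ∷ X) × AcceptsSyntax syntaxStart X X)
  parse-end []      _   = inj₁ refl
  parse-end (x ∷ a) acc with classify x in eq
  ... | ampC      = inj₂ (a , cong (_∷ a) (classify⁻¹ x eq λ ()) , acc)
  ... | digitC _  = ⊥-elim (dead-syntax a acc)
  ... | signC _ _ = ⊥-elim (dead-syntax a acc)
  ... | barC      = ⊥-elim (dead-syntax a acc)
  ... | otherC    = ⊥-elim (dead-syntax a acc)

  record ClauseParse (a : List Γ) : Set where
    constructor clauseParse
    field
      clause     : AClause
      rest       : List Γ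
      a≡         : a ≡ encAClause clause rest
      wellFormed : WellFormed clause
      accepted   : AcceptsSyntax clauseDone rest rest

  parse-clause : ∀ a → AcceptsSyntax syntaxStart a a → ClauseParse a
  parse-clause a acc
    with parse-lit first false a acc
  ... | litParse l₁ X₁ refl nz₁ acc₁ with parse-bar₁ _ X₁ acc₁
  ... | X₂ , refl , acc₂ with parse-lit second _ X₂ acc₂
  ... | litParse l₂ X₃ refl nz₂ acc₃ with parse-bar₂ _ X₃ acc₃
  ... | X₄ , refl , acc₄ with parse-lit third _ X₄ acc₄
  ... | litParse l₃ X₅ refl nz₃ acc₅ with if-true ((annotatedTrue l₁ ∨ annotatedTrue l₂) ∨ annotatedTrue l₃) _ X₅ acc₅
  ... | sat = clauseParse (l₁ , l₂ , l₃) X₅ refl (nz₁ , nz₂ , nz₃ , sat)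
                (subst (λ b → AcceptsSyntax (afterSign third b) X₅ X₅) sat acc₅)

  length<length-encAClause : ∀ c X → length X < length (encAClause c X)
  length<length-encAClause (a , b , c) X =
    <-trans (lit c X) (<-trans (n<1+n _) (<-trans (lit b _) (<-trans (n<1+n _) (lit a _))))
    where
      lit : ∀ l X → length X < length (encALit l X)
      lit (ds , s , v) X rewrite length-++ (map digitSym ds) {signSym s v ∷ X} =
        m≤n+m (suc (length X)) (length (map digitSym ds))

  parse-formula : ∀ n a → length a ≤ n → AcceptsSyntax syntaxStart a a →
    Σ AClause λ c → Σ AFormula λ ρ → (a ≡ encAFormula (c ∷ ρ)) × All WellFormed (c ∷ ρ)
  parse-formula n a a≤n acc with parse-clause a acc
  ... | clauseParse c X refl wf acc′ with parse-end X acc′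
  ... | inj₁ refl = c , [] , refl , wf ∷ []
  parse-formula (suc n) a a≤n acc | clauseParse c X refl wf acc′ | inj₂ (X′ , refl , acc″)
    with parse-formula n X′ (<⇒≤ (≤-pred (≤-trans (length<length-encAClause c (ampSym ∷ X′)) a≤n))) acc″
  ... | c′ , ρ′ , refl , wfs = c , c′ ∷ ρ′ , refl , wf ∷ wfs
  parse-formula zero a a≤n acc | clauseParse c X refl wf acc′ | inj₂ (X′ , refl , acc″)
    with () ← ≤-trans (length<length-encAClause c (ampSym ∷ X′)) a≤n

syntax-sound : ∀ a → Syntax.accepts a a ≡ true →
  Σ AClause λ c → Σ AFormula λ ρ → (a ≡ encAFormula (c ∷ ρ)) × All WellFormed (c ∷ ρ)
syntax-sound a = parse-formula (length a) a ≤-refl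

-- The checks of the counter loop

IsSuccessor : LitPair → Set
IsSuccessor p = fromBits (leftDigits p) ≡ suc (fromBits (rightDigits p))

-- Read from the most significant digit, ds = es + 1 iff ds = w 1 0…0 and es = w 0 1…1;
-- the local state records whether the digit 1 / 0 pair has been passed.
incrementDigit : Bool → Bool → Bool → Maybe Bool
incrementDigit false a     b     = if a =ᵇ b then just false else (if a ∧ not b then just true else nothing)
incrementDigit true  false true  = just true
incrementDigit true  _     _     = nothing

incrementAutomaton : LiteralwiseAutomaton
incrementAutomaton = record
  { Global = ⊤ ; Local = Bool ; finiteGlobal = finite-⊤ ; finiteLocal = finite-Bool
  ; global₀ = tt ; local₀ = false
  ; digitStep = incrementDigit
  ; signStep = λ _ passed _ _ → if passed then just tt else nothing
  ; acceptsGlobal = λ _ → true }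

module Increment = Literalwise incrementAutomaton

private
  passed⇒shape : ∀ ds es → Increment.digitSteps (just true) ds es ≡ just true →
    (ds ≡ replicate (length ds) false) × (es ≡ replicate (length es) true)
  passed⇒shape []           []          _   = refl , refl
  passed⇒shape (false ∷ ds) (true ∷ es) eq with passed⇒shape ds es eq
  ... | ds≡ , es≡ = cong (false ∷_) ds≡ , cong (true ∷_) es≡

  shape⇒passed : ∀ n → Increment.digitSteps (just true) (replicate n false) (replicate n true) ≡ just true
  shape⇒passed zero    = refl
  shape⇒passed (suc n) = shape⇒passed n

  increment-digits-sound : ∀ ds es → Increment.digitSteps (just false) ds es ≡ just true → length ds ≡ length es →
    fromBits ds ≡ suc (fromBits es)
  increment-digits-sound []           []           ()
  increment-digits-sound (false ∷ ds) (true ∷ es)  ()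
  increment-digits-sound []           (_ ∷ _)      ()
  increment-digits-sound (_ ∷ _)      []           ()
  increment-digits-sound (false ∷ ds) (false ∷ es) eq ≡len = increment-digits-sound ds es eq (suc-injective ≡len)
  increment-digits-sound (true ∷ ds)  (true ∷ es)  eq ≡len rewrite suc-injective ≡len =
    trans (cong (2 ^ length es + 0 +_) (increment-digits-sound ds es eq (suc-injective ≡len))) (+-suc (2 ^ length es + 0) (fromBits es))
  increment-digits-sound (true ∷ ds)  (false ∷ es) eq ≡len with passed⇒shape ds es eq
  ... | ds≡ , es≡ = begin
      (2 ^ length ds + 0) + fromBits ds                           ≡⟨ cong (λ t → (2 ^ length ds + 0) + fromBits t) ds≡ ⟩
      (2 ^ length ds + 0) + fromBits (replicate (length ds) false) ≡⟨ cong ((2 ^ length ds + 0) +_) (fromBits-replicate-false (length ds)) ⟩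
      (2 ^ length ds + 0) + 0                                     ≡⟨ trans (+-identityʳ _) (+-identityʳ _) ⟩
      2 ^ length ds                                               ≡⟨ cong (2 ^_) (suc-injective ≡len) ⟩
      2 ^ length es                                               ≡⟨ sym (1+fromBits-replicate-true (length es)) ⟩
      suc (fromBits (replicate (length es) true))                 ≡⟨ cong (suc ∘ fromBits) (sym es≡) ⟩
      suc (fromBits es)                                           ∎
    where open ≡-Reasoning

  increment-digits-complete : ∀ ds es → length ds ≡ length es → fromBits ds ≡ suc (fromBits es) →
    Increment.digitSteps (just false) ds es ≡ just true
  increment-digits-complete []           []          _    ()
  increment-digits-complete (false ∷ ds) (false ∷ es) ≡len ≡val = increment-digits-complete ds es (suc-injective ≡len) ≡val
  increment-digits-complete (true ∷ ds)  (true ∷ es)  ≡len ≡val rewrite suc-injective ≡len =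
    increment-digits-complete ds es (suc-injective ≡len)
      (+-cancelˡ-≡ (2 ^ length es + 0) (fromBits ds) (suc (fromBits es)) (trans ≡val (sym (+-suc (2 ^ length es + 0) (fromBits es)))))
  increment-digits-complete (false ∷ ds) (true ∷ es)  ≡len ≡val = ⊥-elim (<⇒≱ (fromBits<2^length ds) (begin
      2 ^ length ds                        ≡⟨ cong (2 ^_) (suc-injective ≡len) ⟩
      2 ^ length es                        ≤⟨ 2^length≤fromBits-true es ⟩
      fromBits (true ∷ es)                 ≤⟨ n≤1+n _ ⟩
      suc (fromBits (true ∷ es))           ≡⟨ sym ≡val ⟩
      fromBits ds                          ∎))
    where open ≤-Reasoning
  increment-digits-complete (true ∷ ds)  (false ∷ es) ≡len ≡val =
    subst₂ (λ a b → Increment.digitSteps (just true) a b ≡ just true) (sym ds≡) (sym es≡)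
      (subst (λ k → Increment.digitSteps (just true) (replicate n false) (replicate k true) ≡ just true) n≡ (shape⇒passed n))
    where
      n = length ds
      n≡ : length ds ≡ length es
      n≡ = suc-injective ≡len
      2^n+ds≤2^n : (2 ^ n + 0) + fromBits ds ≤ 2 ^ n
      2^n+ds≤2^n = ≤-trans (≤-reflexive ≡val) (subst (λ k → suc (fromBits es) ≤ 2 ^ k) (sym n≡) (fromBits<2^length es))
      ds≡0 : fromBits ds ≡ 0
      ds≡0 = n≤0⇒n≡0 (+-cancelˡ-≤ (2 ^ n + 0) (fromBits ds) 0
               (≤-trans 2^n+ds≤2^n (≤-reflexive (sym (trans (+-identityʳ (2 ^ n + 0)) (+-identityʳ (2 ^ n)))))))
      1+es≡2^n : suc (fromBits es) ≡ 2 ^ length es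
      1+es≡2^n = trans (sym ≡val) (trans (cong ((2 ^ n + 0) +_) ds≡0)
                   (trans (+-identityʳ _) (trans (+-identityʳ _) (cong (2 ^_) n≡))))
      ds≡ : ds ≡ replicate (length ds) false
      ds≡ = fromBits-injective ds _ (sym (length-replicate (length ds))) (trans ds≡0 (sym (fromBits-replicate-false (length ds))))
      es≡ : es ≡ replicate (length es) true
      es≡ = fromBits-injective es _ (sym (length-replicate (length es)))
              (suc-injective (trans 1+es≡2^n (sym (1+fromBits-replicate-true (length es)))))

increment-fold-sound : ∀ ps → All SameLength ps →
  Increment.acceptsResult (Increment.foldLits (just tt) ps) ≡ true → All IsSuccessor ps
increment-fold-sound []                    []          _   = []
increment-fold-sound ((ds , es , s , v) ∷ ps) (eq ∷ eqs) acc with Increment.digitSteps (just false) ds es in steps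
... | just true  = increment-digits-sound ds es steps eq ∷ increment-fold-sound ps eqs acc
... | just false with () ← trans (sym (cong Increment.acceptsResult (Increment.foldLits-nothing ps))) acc
... | nothing    with () ← trans (sym (cong Increment.acceptsResult (Increment.foldLits-nothing ps))) acc

increment-fold-complete : ∀ ps → All SameLength ps → All IsSuccessor ps →
  Increment.foldLits (just tt) ps ≡ just tt
increment-fold-complete []                    []          []         = refl
increment-fold-complete ((ds , es , s , v) ∷ ps) (eq ∷ eqs) (succ ∷ succs)
  rewrite increment-digits-complete ds es eq succ = increment-fold-complete ps eqs succs

_=ᴸ_ : List Bool → List Bool → Bool
[]       =ᴸ []       = true
(d ∷ ds) =ᴸ (e ∷ es) = (d =ᵇ e) ∧ (ds =ᴸ es)
_        =ᴸ _        = false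

=ᴸ⇒≡ : ∀ ds es → ds =ᴸ es ≡ true → ds ≡ es
=ᴸ⇒≡ []       []       _  = refl
=ᴸ⇒≡ (d ∷ ds) (e ∷ es) eq with d =ᵇ e in d=e
... | true = cong₂ _∷_ (=ᵇ⇒≡ d e d=e) (=ᴸ⇒≡ ds es eq)

=ᴸ-refl : ∀ ds → ds =ᴸ ds ≡ true
=ᴸ-refl []       = refl
=ᴸ-refl (d ∷ ds) rewrite =ᵇ-refl d = =ᴸ-refl ds

SameName : LitPair → Set
SameName p = leftDigits p ≡ rightDigits p

valueOfPair : LitPair → Bool
valueOfPair (_ , _ , _ , v) = v

-- Global state: whether a literal with the counter's name was found, and the value it carries;
-- a second such literal with a different value kills the run.
record-value : Maybe Bool → Bool → Maybe (Bool × Maybe Bool)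
record-value nothing  v = just (true , just v)
record-value (just w) v = if w =ᵇ v then just (true , just v) else nothing

occurrenceAutomaton : LiteralwiseAutomaton
occurrenceAutomaton = record
  { Global = Bool × Maybe Bool ; Local = Bool
  ; finiteGlobal = finite-× finite-Bool (finite-Maybe finite-Bool) ; finiteLocal = finite-Bool
  ; global₀ = false , nothing ; local₀ = true
  ; digitStep = λ same a b → just (same ∧ (a =ᵇ b))
  ; signStep = λ g same _ v → if same then record-value (proj₂ g) v else just g
  ; acceptsGlobal = proj₁ }

module Occurrence = Literalwise occurrenceAutomaton

private
  occurrence-digits : ∀ same ds es → length ds ≡ length es →
    Occurrence.digitSteps (just same) ds es ≡ just (same ∧ (ds =ᴸ es))
  occurrence-digits same []       []       _    rewrite ∧-identityʳ same = refl
  occurrence-digits same (d ∷ ds) (e ∷ es) ≡len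
    rewrite occurrence-digits (same ∧ (d =ᵇ e)) ds es (suc-injective ≡len) | ∧-assoc same (d =ᵇ e) (ds =ᴸ es) = refl

  ¬SameName : ∀ ds es → ds =ᴸ es ≡ false → ¬ (ds ≡ es)
  ¬SameName ds .ds ne refl with () ← trans (sym (=ᴸ-refl ds)) ne

occurrence-fold-sound : ∀ ps found m found′ m′ → All SameLength ps →
  Occurrence.foldLits (just (found , m)) ps ≡ just (found′ , m′) →
  All (λ p → SameName p → m′ ≡ just (valueOfPair p)) ps
  × (found′ ≡ true → found ≡ true ⊎ Any SameName ps)
  × (∀ w → m ≡ just w → m′ ≡ just w)
occurrence-fold-sound [] found m found′ m′ [] refl = [] , inj₁ , λ _ eq → eq
occurrence-fold-sound ((ds , es , s , v) ∷ ps) found m found′ m′ (eq ∷ eqs) run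
  rewrite occurrence-digits true ds es eq with ds =ᴸ es in same
... | false with occurrence-fold-sound ps found m found′ m′ eqs run
...   | vals , founds , keeps =
          (λ p → ⊥-elim (¬SameName ds es same p)) ∷ vals , (λ t → map₂ there (founds t)) , keeps
occurrence-fold-sound ((ds , es , s , v) ∷ ps) found nothing found′ m′ (eq ∷ eqs) run | true
  with occurrence-fold-sound ps true (just v) found′ m′ eqs run
... | vals , _ , keeps = (λ _ → keeps v refl) ∷ vals , (λ _ → inj₂ (here (=ᴸ⇒≡ ds es same))) , λ _ ()
occurrence-fold-sound ((ds , es , s , v) ∷ ps) found (just w) found′ m′ (eq ∷ eqs) run | true
  with w =ᵇ v in w=v
... | true with occurrence-fold-sound ps true (just v) found′ m′ eqs run
...   | vals , _ , keeps =
          (λ _ → keeps v refl) ∷ vals , (λ _ → inj₂ (here (=ᴸ⇒≡ ds es same))) ,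
          (λ w′ eq′ → trans (keeps v refl) (cong just (trans (sym (=ᵇ⇒≡ w v w=v)) (just-injective eq′))))
occurrence-fold-sound ((ds , es , s , v) ∷ ps) found (just w) found′ m′ (eq ∷ eqs) run | true | false
  rewrite Occurrence.foldLits-nothing ps with () ← run

occurrence-fold-complete : ∀ ps v₀ found m → All SameLength ps → All (λ p → SameName p → valueOfPair p ≡ v₀) ps →
  (m ≡ nothing ⊎ m ≡ just v₀) →
  Σ Bool λ found′ → Σ (Maybe Bool) λ m′ → (Occurrence.foldLits (just (found , m)) ps ≡ just (found′ , m′))
    × (found ≡ true ⊎ Any SameName ps → found′ ≡ true)
occurrence-fold-complete [] v₀ found m [] [] _ = found , m , refl , λ { (inj₁ eq) → eq ; (inj₂ ()) }
occurrence-fold-complete ((ds , es , s , v) ∷ ps) v₀ found m (eq ∷ eqs) (c ∷ cs) m-ok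
  rewrite occurrence-digits true ds es eq with ds =ᴸ es in same
... | false with occurrence-fold-complete ps v₀ found m eqs cs m-ok
...   | found′ , m′ , run , finds = found′ , m′ , run ,
          λ { (inj₁ f)         → finds (inj₁ f)
            ; (inj₂ (here p))  → ⊥-elim (¬SameName ds es same p)
            ; (inj₂ (there a)) → finds (inj₂ a) }
occurrence-fold-complete ((ds , es , s , v) ∷ ps) v₀ found nothing (eq ∷ eqs) (c ∷ cs) m-ok | true
  with occurrence-fold-complete ps v₀ true (just v) eqs cs (inj₂ (cong just (c (=ᴸ⇒≡ ds es same))))
... | found′ , m′ , run , finds = found′ , m′ , run , λ _ → finds (inj₁ refl)
occurrence-fold-complete ((ds , es , s , v) ∷ ps) v₀ found (just w) (eq ∷ eqs) (c ∷ cs) (inj₂ refl) | true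
  rewrite c (=ᴸ⇒≡ ds es same) | =ᵇ-refl v₀ with occurrence-fold-complete ps v₀ true (just v₀) eqs cs (inj₂ refl)
... | found′ , m′ , run , finds = found′ , m′ , run , λ _ → finds (inj₁ refl)

-- The local state is the right digit at the first column where the two names differ.
compareDigit : Maybe Bool → Bool → Bool → Maybe Bool
compareDigit nothing  a b = if a =ᵇ b then nothing else just b
compareDigit (just c) _ _ = just c

notGreater : Maybe Bool → Bool
notGreater (just false) = false
notGreater _            = true

boundAutomaton : LiteralwiseAutomaton
boundAutomaton = record
  { Global = Bool ; Local = Maybe Bool ; finiteGlobal = finite-Bool ; finiteLocal = finite-Maybe finite-Bool
  ; global₀ = true ; local₀ = nothing
  ; digitStep = λ c a b → just (compareDigit c a b)
  ; signStep = λ ok c _ _ → just (ok ∧ notGreater c)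
  ; acceptsGlobal = λ ok → ok }

module Bound = Literalwise boundAutomaton

compareDigits : Maybe Bool → List Bool → List Bool → Maybe Bool
compareDigits c (a ∷ as) (b ∷ bs) = compareDigits (compareDigit c a b) as bs
compareDigits c _        _        = c

LeftAtMost LeftGreater : LitPair → Set
LeftAtMost  p = fromBits (leftDigits p) ≤ fromBits (rightDigits p)
LeftGreater p = fromBits (rightDigits p) < fromBits (leftDigits p)

private
  bound-digits : ∀ c ds es → length ds ≡ length es → Bound.digitSteps (just c) ds es ≡ just (compareDigits c ds es)
  bound-digits c []       []       _    = refl
  bound-digits c (d ∷ ds) (e ∷ es) ≡len = bound-digits (compareDigit c d e) ds es (suc-injective ≡len)

  compareDigits-just : ∀ x ds es → compareDigits (just x) ds es ≡ just x
  compareDigits-just x []       _        = refl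
  compareDigits-just x (_ ∷ _)  []       = refl
  compareDigits-just x (d ∷ ds) (e ∷ es) = compareDigits-just x ds es

  compare-greater : ∀ ds es → length ds ≡ length es → notGreater (compareDigits nothing ds es) ≡ false →
    fromBits es < fromBits ds
  compare-greater []       []       _    ()
  compare-greater (d ∷ ds) (e ∷ es) ≡len ng with d =ᵇ e in d=e
  ... | true rewrite =ᵇ⇒≡ d e d=e | suc-injective ≡len =
    +-monoʳ-< (bit e * 2 ^ length es) (compare-greater ds es (suc-injective ≡len) ng)
  compare-greater (true ∷ ds) (false ∷ es) ≡len ng | false rewrite suc-injective ≡len =
    <-≤-trans (fromBits<2^length es) (≤-trans (m≤m+n (2 ^ length es) 0) (m≤m+n (2 ^ length es + 0) (fromBits ds)))
  compare-greater (false ∷ ds) (true ∷ es) ≡len ng | false rewrite compareDigits-just true ds es with () ← ng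

  compare-atMost : ∀ ds es → length ds ≡ length es → notGreater (compareDigits nothing ds es) ≡ true →
    fromBits ds ≤ fromBits es
  compare-atMost []       []       _    _  = z≤n
  compare-atMost (d ∷ ds) (e ∷ es) ≡len ng with d =ᵇ e in d=e
  ... | true rewrite =ᵇ⇒≡ d e d=e | suc-injective ≡len =
    +-monoʳ-≤ (bit e * 2 ^ length es) (compare-atMost ds es (suc-injective ≡len) ng)
  compare-atMost (false ∷ ds) (true ∷ es) ≡len ng | false =
    <⇒≤ (<-≤-trans (fromBits<2^length ds)
          (subst (λ n → 2 ^ n ≤ fromBits (true ∷ es)) (sym (suc-injective ≡len)) (2^length≤fromBits-true es)))
  compare-atMost (true ∷ ds) (false ∷ es) ≡len ng | false rewrite compareDigits-just false ds es with () ← ng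

allAtMost : Bool → List LitPair → Bool
allAtMost ok []       = ok
allAtMost ok (p ∷ ps) = allAtMost (ok ∧ notGreater (compareDigits nothing (leftDigits p) (rightDigits p))) ps

allAtMost-false : ∀ ps → allAtMost false ps ≡ false
allAtMost-false []       = refl
allAtMost-false (p ∷ ps) = allAtMost-false ps

bound-fold : ∀ ok ps → All SameLength ps → Bound.foldLits (just ok) ps ≡ just (allAtMost ok ps)
bound-fold ok []                    []          = refl
bound-fold ok ((ds , es , s , v) ∷ ps) (eq ∷ eqs) rewrite bound-digits nothing ds es eq = bound-fold _ ps eqs

allAtMost-sound : ∀ ps → All SameLength ps → allAtMost true ps ≡ true → All LeftAtMost ps
allAtMost-sound []                    []          _  = []
allAtMost-sound ((ds , es , s , v) ∷ ps) (eq ∷ eqs) ok with notGreater (compareDigits nothing ds es) in ng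
... | true  = compare-atMost ds es eq ng ∷ allAtMost-sound ps eqs ok
... | false with () ← trans (sym (allAtMost-false ps)) ok

allAtMost-complete : ∀ ps → All SameLength ps → All LeftAtMost ps → allAtMost true ps ≡ true
allAtMost-complete []                    []          []         = refl
allAtMost-complete ((ds , es , s , v) ∷ ps) (eq ∷ eqs) (le ∷ les) with notGreater (compareDigits nothing ds es) in ng
... | true  = allAtMost-complete ps eqs les
... | false = ⊥-elim (<⇒≱ (compare-greater ds es eq ng) le)

allAtMost-reject : ∀ ok ps → All SameLength ps → Any LeftGreater ps → allAtMost ok ps ≡ false
allAtMost-reject ok ((ds , es , s , v) ∷ ps) (eq ∷ eqs) (here gt) with notGreater (compareDigits nothing ds es) in ng
... | true  = ⊥-elim (<⇒≱ gt (compare-atMost ds es eq ng))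
... | false rewrite ∧-zeroʳ ok = allAtMost-false ps
allAtMost-reject ok (p ∷ ps) (eq ∷ eqs) (there gt) = allAtMost-reject _ ps eqs gt

leadingOneAutomaton : LiteralwiseAutomaton
leadingOneAutomaton = record
  { Global = Bool ; Local = Maybe Bool ; finiteGlobal = finite-Bool ; finiteLocal = finite-Maybe finite-Bool
  ; global₀ = true ; local₀ = nothing
  ; digitStep = λ { nothing a _ → just (just a) ; (just x) _ _ → just (just x) }
  ; signStep = λ ok first _ _ → just (ok ∧ fromMaybe false first)
  ; acceptsGlobal = λ ok → ok }

module LeadingOne = Literalwise leadingOneAutomaton

headIsOne : List Bool → Bool
headIsOne []      = false
headIsOne (d ∷ _) = d

leadingOne⇒width : ∀ L k → k < 2 ^ L → headIsOne (toBits L k) ≡ true → L ≡ bits k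
leadingOne⇒width zero    k _   ()
leadingOne⇒width (suc n) k fit lead with toBits (suc n) k in eq
... | []    with () ← lead
... | d ∷ r = cong suc (sym (⌊log₂⌋-unique k n 2^n≤k fit))
  where
    |r|≡n : length r ≡ n
    |r|≡n = suc-injective (trans (cong length (sym eq)) (length-toBits (suc n) k))
    value : fromBits (d ∷ r) ≡ k
    value = trans (cong fromBits (sym eq)) (fromBits-toBits (suc n) k fit)
    2^n≤k : 2 ^ n ≤ k
    2^n≤k = subst₂ (λ a b → 2 ^ a ≤ b) |r|≡n value
              (subst (λ d → 2 ^ length r ≤ fromBits (d ∷ r)) (sym lead) (2^length≤fromBits-true r))

width⇒leadingOne : ∀ k → 1 ≤ k → headIsOne (toBits (bits k) k) ≡ true
width⇒leadingOne k 1≤k with toBits (bits k) k in eq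
... | []    with () ← trans (cong length (sym eq)) (length-toBits (bits k) k)
... | d ∷ r = 2^length≤fromBits⇒leading-true d r (subst₂ (λ a b → 2 ^ a ≤ b) (sym |r|≡log) (sym value) (2^⌊log₂n⌋≤n k 1≤k))
  where
    |r|≡log : length r ≡ ⌊log₂ k ⌋
    |r|≡log = suc-injective (trans (cong length (sym eq)) (length-toBits (bits k) k))
    value : fromBits (d ∷ r) ≡ k
    value = trans (cong fromBits (sym eq)) (fromBits-toBits (bits k) k (n<2^[1+⌊log₂n⌋] k))

LeadingOneLeft : LitPair → Set
LeadingOneLeft p = headIsOne (leftDigits p) ≡ true

allLeadingOne : Bool → List LitPair → Bool
allLeadingOne ok []       = ok
allLeadingOne ok (p ∷ ps) = allLeadingOne (ok ∧ headIsOne (leftDigits p)) ps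

allLeadingOne-false : ∀ ps → allLeadingOne false ps ≡ false
allLeadingOne-false []       = refl
allLeadingOne-false (p ∷ ps) = allLeadingOne-false ps

private
  leadingOne-keep : ∀ x ds es → length ds ≡ length es → LeadingOne.digitSteps (just (just x)) ds es ≡ just (just x)
  leadingOne-keep x []       []       _    = refl
  leadingOne-keep x (d ∷ ds) (e ∷ es) ≡len = leadingOne-keep x ds es (suc-injective ≡len)

leadingOne-fold : ∀ ok ps → All SameLength ps → LeadingOne.foldLits (just ok) ps ≡ just (allLeadingOne ok ps)
leadingOne-fold ok []                            []          = refl
leadingOne-fold ok (([] , [] , s , v) ∷ ps)      (eq ∷ eqs) = leadingOne-fold _ ps eqs
leadingOne-fold ok ((d ∷ ds , e ∷ es , s , v) ∷ ps) (eq ∷ eqs)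
  rewrite leadingOne-keep d ds es (suc-injective eq) = leadingOne-fold _ ps eqs

allLeadingOne-sound : ∀ ps → allLeadingOne true ps ≡ true → All LeadingOneLeft ps
allLeadingOne-sound []                    _  = []
allLeadingOne-sound ((ds , es , s , v) ∷ ps) ok with headIsOne ds in hd
... | true  = hd ∷ allLeadingOne-sound ps ok
... | false with () ← trans (sym (allLeadingOne-false ps)) ok

allLeadingOne-complete : ∀ ps → All LeadingOneLeft ps → allLeadingOne true ps ≡ true
allLeadingOne-complete []                    []         = refl
allLeadingOne-complete ((ds , es , s , v) ∷ ps) (h ∷ hs) rewrite h = allLeadingOne-complete ps hs

-- Counter words and annotations

-- The counter word of i is the annotated formula with every variable name replaced by i, in the same width.

counterLit : ℕ → ALit → ALit
counterLit i (ds , s , v) = toBits (length ds) i , s , v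

counterF : ℕ → AFormula → AFormula
counterF i = mapAF (counterLit i)

pairWithCounter : ℕ → ALit → LitPair
pairWithCounter i (ds , s , v) = ds , toBits (length ds) i , s , v

diagonal : ALit → LitPair
diagonal (ds , s , v) = ds , ds , s , v

incrementPair : ℕ → ALit → LitPair
incrementPair i (ds , s , v) = toBits (length ds) (suc i) , toBits (length ds) i , s , v

leftF-pairWithCounter : ∀ i ρ → leftF (liftAF (pairWithCounter i) ρ) ≡ ρ
leftF-pairWithCounter i ρ = trans (leftF-liftAF (pairWithCounter i) ρ) (mapAF-id ρ)

leftF-diagonal : ∀ ρ → leftF (liftAF diagonal ρ) ≡ ρ
leftF-diagonal ρ = trans (leftF-liftAF diagonal ρ) (mapAF-id ρ)

rightF-diagonal : ∀ ρ → rightF (liftAF diagonal ρ) ≡ ρ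
rightF-diagonal ρ = trans (rightF-liftAF diagonal ρ) (mapAF-id ρ)

sameLengths-pairWithCounter : ∀ i ρ → SameLengths (liftAF (pairWithCounter i) ρ)
sameLengths-pairWithCounter i = sameLengths-liftAF _ λ { (ds , _ , _) → sym (length-toBits (length ds) i) }

sameLengths-diagonal : ∀ ρ → SameLengths (liftAF diagonal ρ)
sameLengths-diagonal = sameLengths-liftAF _ λ _ → refl

sameLengths-incrementPair : ∀ i ρ → SameLengths (liftAF (incrementPair i) ρ)
sameLengths-incrementPair i = sameLengths-liftAF _ λ { (ds , _ , _) →
  trans (length-toBits (length ds) (suc i)) (sym (length-toBits (length ds) i)) }

Fits : ℕ → ALit → Set
Fits i l = i < 2 ^ length (digitsOf l)

isSuccessor-incrementPair : ∀ i ρ → All (Fits (suc i)) (alits ρ) → All IsSuccessor (litPairs (liftAF (incrementPair i) ρ))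
isSuccessor-incrementPair i ρ fits =
  subst (All IsSuccessor) (sym (litPairs-liftAF (incrementPair i) ρ)) (All.map⁺ (All.map (λ {l} → succ l) fits))
  where
    succ : ∀ l → Fits (suc i) l → IsSuccessor (incrementPair i l)
    succ (ds , _ , _) fit = trans (fromBits-toBits (length ds) (suc i) fit)
                                  (cong suc (sym (fromBits-toBits (length ds) i (<-trans (n<1+n i) fit))))

private
  increment-lit : ∀ i p l → rightLit p ≡ counterLit i l → SameLength p → IsSuccessor p → Fits i l →
    (leftLit p ≡ counterLit (suc i) l) × Fits (suc i) l
  increment-lit i (ds , .(toBits (length dl) i) , .s , .v) (dl , s , v) refl ≡len succ fit =
    cong (_, s , v) (trans (sym (toBits-fromBits ds)) (cong₂ toBits ≡len′ ds≡1+i)) , fit′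
    where
      ≡len′ : length ds ≡ length dl
      ≡len′ = trans ≡len (length-toBits (length dl) i)
      ds≡1+i : fromBits ds ≡ suc i
      ds≡1+i = trans succ (cong suc (fromBits-toBits (length dl) i fit))
      fit′ : suc i < 2 ^ length dl
      fit′ = subst₂ (λ a b → a < 2 ^ b) ds≡1+i ≡len′ (fromBits<2^length ds)

increment-step : ∀ i π ρ → rightF π ≡ counterF i ρ → SameLengths π → All IsSuccessor (litPairs π) →
  All (Fits i) (alits ρ) → (leftF π ≡ counterF (suc i) ρ) × All (Fits (suc i)) (alits ρ)
increment-step i [] [] _ _ _ _ = refl , []
increment-step i ((p₁ , p₂ , p₃) ∷ π) ((l₁ , l₂ , l₃) ∷ ρ) eq (e₁ ∷ e₂ ∷ e₃ ∷ es) (s₁ ∷ s₂ ∷ s₃ ∷ ss) (f₁ ∷ f₂ ∷ f₃ ∷ fs)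
  with ∷-injective eq
... | hd , tl with increment-step i π ρ tl es ss fs | hd
... | left≡ , fits | refl
  with increment-lit i p₁ l₁ refl e₁ s₁ f₁ | increment-lit i p₂ l₂ refl e₂ s₂ f₂ | increment-lit i p₃ l₃ refl e₃ s₃ f₃
... | r₁ , g₁ | r₂ , g₂ | r₃ , g₃ = cong₂ _∷_ (cong₂ _,_ r₁ (cong₂ _,_ r₂ r₃)) left≡ , g₁ ∷ g₂ ∷ g₃ ∷ fits

zeroDigits : Γ → Γ
zeroDigits (inj₁ s1) = inj₁ s0
zeroDigits x         = x

private
  zeroDigits-digits : ∀ ds → map zeroDigits (map digitSym ds) ≡ map digitSym (toBits (length ds) 0)
  zeroDigits-digits ds = trans (go ds) (cong (map digitSym) (sym (toBits-zero (length ds))))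
    where
      go : ∀ ds → map zeroDigits (map digitSym ds) ≡ map digitSym (replicate (length ds) false)
      go []           = refl
      go (false ∷ ds) = cong (_ ∷_) (go ds)
      go (true ∷ ds)  = cong (_ ∷_) (go ds)

  zeroDigits-lit : ∀ l X → map zeroDigits (encALit l X) ≡ encALit (counterLit 0 l) (map zeroDigits X)
  zeroDigits-lit (ds , s , v) X
    rewrite map-++ zeroDigits (map digitSym ds) (signSym s v ∷ X) | zeroDigits-digits ds = refl

  zeroDigits-clause : ∀ a b c X → map zeroDigits (encAClause (a , b , c) X)
                      ≡ encAClause (counterLit 0 a , counterLit 0 b , counterLit 0 c) (map zeroDigits X)
  zeroDigits-clause a b c X
    rewrite zeroDigits-lit a (barSym ∷ encALit b (barSym ∷ encALit c X))
          | zeroDigits-lit b (barSym ∷ encALit c X) | zeroDigits-lit c X = refl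

  zeroDigits-tail : ∀ ρ → map zeroDigits (encAFormulaTail ρ) ≡ encAFormulaTail (counterF 0 ρ)
  zeroDigits-tail []                = refl
  zeroDigits-tail ((a , b , c) ∷ ρ)
    rewrite zeroDigits-clause a b c (encAFormulaTail ρ) | zeroDigits-tail ρ = refl

map-zeroDigits-encAFormula : ∀ ρ → map zeroDigits (encAFormula ρ) ≡ encAFormula (counterF 0 ρ)
map-zeroDigits-encAFormula []                = refl
map-zeroDigits-encAFormula ((a , b , c) ∷ ρ)
  rewrite zeroDigits-clause a b c (encAFormulaTail ρ) | zeroDigits-tail ρ = refl

annotate : ℕ → (ℕ → Bool) → Literal → ALit
annotate L α (i , s) = toBits L i , s , α i

annotateClause : ℕ → (ℕ → Bool) → Clause → AClause
annotateClause L α (a , b , c) = annotate L α a , annotate L α b , annotate L α c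

signOf : Bool → Sym
signOf s = if s then plus else minus

erase : Γ → Γ
erase (inj₁ x)                   = inj₁ x
erase (inj₂ zero)                = inj₁ plus
erase (inj₂ (suc zero))          = inj₁ plus
erase (inj₂ (suc (suc _)))       = inj₁ minus

private
  erase-signSym : ∀ s v → erase (signSym s v) ≡ inj₁ (signOf s)
  erase-signSym true  true  = refl
  erase-signSym true  false = refl
  erase-signSym false true  = refl
  erase-signSym false false = refl

  erase-lit : ∀ L α l X → map erase (encALit (annotate L α l) X) ≡ map inj₁ (encLit L l) ++ map erase X
  erase-lit L α (i , s) X = begin
      map erase (map digitSym (toBits L i) ++ signSym s (α i) ∷ X)
    ≡⟨ map-++ erase (map digitSym (toBits L i)) (signSym s (α i) ∷ X) ⟩
      map erase (map digitSym (toBits L i)) ++ erase (signSym s (α i)) ∷ map erase X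
    ≡⟨ cong₂ (λ a b → a ++ b ∷ map erase X) (erase-digits (toBits L i)) (erase-signSym s (α i)) ⟩
      map inj₁ (map digit (toBits L i)) ++ inj₁ (signOf s) ∷ map erase X
    ≡⟨ cong (λ t → map inj₁ t ++ inj₁ (signOf s) ∷ map erase X) (sym (bin≡map-digit-toBits L i)) ⟩
      map inj₁ (bin L i) ++ inj₁ (signOf s) ∷ map erase X
    ≡⟨ sym (++-assoc (map inj₁ (bin L i)) (inj₁ (signOf s) ∷ []) (map erase X)) ⟩
      (map inj₁ (bin L i) ++ inj₁ (signOf s) ∷ []) ++ map erase X
    ≡⟨ cong (_++ map erase X) (sym (map-++ inj₁ (bin L i) (signOf s ∷ []))) ⟩
      map inj₁ (encLit L (i , s)) ++ map erase X
    ∎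
    where
      open ≡-Reasoning
      erase-digits : ∀ ds → map erase (map digitSym ds) ≡ map inj₁ (map digit ds)
      erase-digits []       = refl
      erase-digits (d ∷ ds) = cong (_ ∷_) (erase-digits ds)

  erase-clause : ∀ L α c X → map erase (encAClause (annotateClause L α c) X) ≡ map inj₁ (encClause L c) ++ map erase X
  erase-clause L α (a , b , c) X = begin
      map erase (encALit (annotate L α a) (barSym ∷ encALit (annotate L α b) (barSym ∷ encALit (annotate L α c) X)))
    ≡⟨ erase-lit L α a _ ⟩
      Ea ++ inj₁ bar ∷ map erase (encALit (annotate L α b) (barSym ∷ encALit (annotate L α c) X))
    ≡⟨ cong (λ t → Ea ++ inj₁ bar ∷ t) (erase-lit L α b _) ⟩
      Ea ++ inj₁ bar ∷ (Eb ++ inj₁ bar ∷ map erase (encALit (annotate L α c) X))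
    ≡⟨ cong (λ t → Ea ++ inj₁ bar ∷ (Eb ++ inj₁ bar ∷ t)) (erase-lit L α c X) ⟩
      Ea ++ inj₁ bar ∷ (Eb ++ inj₁ bar ∷ (Ec ++ map erase X))
    ≡⟨ cong (λ t → Ea ++ inj₁ bar ∷ t) (sym (++-assoc Eb (inj₁ bar ∷ Ec) (map erase X))) ⟩
      Ea ++ inj₁ bar ∷ ((Eb ++ inj₁ bar ∷ Ec) ++ map erase X)
    ≡⟨ sym (++-assoc Ea (inj₁ bar ∷ (Eb ++ inj₁ bar ∷ Ec)) (map erase X)) ⟩
      (Ea ++ inj₁ bar ∷ (Eb ++ inj₁ bar ∷ Ec)) ++ map erase X
    ≡⟨ cong (λ t → (Ea ++ inj₁ bar ∷ t) ++ map erase X) (sym (map-++ inj₁ (encLit L b) (bar ∷ encLit L c))) ⟩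
      (Ea ++ inj₁ bar ∷ map inj₁ (encLit L b ++ bar ∷ encLit L c)) ++ map erase X
    ≡⟨ cong (_++ map erase X) (sym (map-++ inj₁ (encLit L a) (bar ∷ encLit L b ++ bar ∷ encLit L c))) ⟩
      map inj₁ (encClause L (a , b , c)) ++ map erase X
    ∎
    where
      open ≡-Reasoning
      Ea = map inj₁ (encLit L a)
      Eb = map inj₁ (encLit L b)
      Ec = map inj₁ (encLit L c)

erase-encAFormula : ∀ L α φ → map erase (encAFormula (map (annotateClause L α) φ)) ≡ map inj₁ (encFormula L φ)
erase-encAFormula L α []           = refl
erase-encAFormula L α (c ∷ [])     = trans (erase-clause L α c []) (++-identityʳ _)
erase-encAFormula L α (c ∷ c′ ∷ φ) = begin
    map erase (encAClause (annotateClause L α c) (ampSym ∷ encAFormula (map (annotateClause L α) (c′ ∷ φ))))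
  ≡⟨ erase-clause L α c _ ⟩
    map inj₁ (encClause L c) ++ inj₁ amp ∷ map erase (encAFormula (map (annotateClause L α) (c′ ∷ φ)))
  ≡⟨ cong (λ t → map inj₁ (encClause L c) ++ inj₁ amp ∷ t) (erase-encAFormula L α (c′ ∷ φ)) ⟩
    map inj₁ (encClause L c) ++ map inj₁ (amp ∷ encFormula L (c′ ∷ φ))
  ≡⟨ sym (map-++ inj₁ (encClause L c) (amp ∷ encFormula L (c′ ∷ φ))) ⟩
    map inj₁ (encFormula L (c ∷ c′ ∷ φ))
  ∎
  where open ≡-Reasoning

-- Reading off a satisfiable formula

Consistent : ℕ → List ALit → Set
Consistent j ls = ∀ {l₁ l₂} → l₁ ∈ ls → l₂ ∈ ls → variableOf l₁ ≡ j → variableOf l₂ ≡ j → valueOf l₁ ≡ valueOf l₂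

-- What an accepting run establishes about its guessed annotated formula ρ and final counter k.
record Certificate (x : List Sym) : Set where
  field
    ρ          : AFormula
    k          : ℕ
    encodes    : map erase (encAFormula ρ) ≡ map inj₁ x
    wellFormed : All WellFormed ρ
    widths     : All (λ l → length (digitsOf l) ≡ bits k) (alits ρ)
    atMost     : All (λ l → variableOf l ≤ k) (alits ρ)
    occurs     : ∀ j → 1 ≤ j → j ≤ k → Any (λ l → variableOf l ≡ j) (alits ρ)
    consistent : ∀ j → 1 ≤ j → j ≤ k → Consistent j (alits ρ)

stripLit : ALit → Literal
stripLit (ds , s , _) = fromBits ds , s

stripClause : AClause → Clause
stripClause (a , b , c) = stripLit a , stripLit b , stripLit c

vars-strip : ∀ ρ → vars (map stripClause ρ) ≡ map variableOf (alits ρ)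
vars-strip []                = refl
vars-strip ((a , b , c) ∷ ρ) = cong (λ t → variableOf a ∷ variableOf b ∷ variableOf c ∷ t) (vars-strip ρ)

assignmentOf : List ALit → ℕ → Bool
assignmentOf []       i = false
assignmentOf (l ∷ ls) i = if variableOf l ≡ᵇ i then valueOf l else assignmentOf ls i

assignmentOf-consistent : ∀ ls → (∀ {l₁ l₂} → l₁ ∈ ls → l₂ ∈ ls → variableOf l₁ ≡ variableOf l₂ → valueOf l₁ ≡ valueOf l₂) →
  ∀ {l} → l ∈ ls → assignmentOf ls (variableOf l) ≡ valueOf l
assignmentOf-consistent (l₀ ∷ ls) cons {l} l∈ with variableOf l₀ ≡ᵇ variableOf l in eq
... | true = cons (here refl) l∈ (≡ᵇ⇒≡ (variableOf l₀) (variableOf l) (subst T (sym eq) tt))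
... | false with l∈
...   | here refl = ⊥-elim (subst T eq (≡⇒≡ᵇ (variableOf l₀) (variableOf l₀) refl))
...   | there l∈′ = assignmentOf-consistent ls (λ a b → cons (there a) (there b)) l∈′

private
  NonzeroName⇒1≤ : ∀ ds → or ds ≡ true → 1 ≤ fromBits ds
  NonzeroName⇒1≤ (true ∷ ds)  _  = ≤-trans (m^n>0 2 (length ds)) (2^length≤fromBits-true ds)
  NonzeroName⇒1≤ (false ∷ ds) nz = NonzeroName⇒1≤ ds nz

  nonzeroNames : ∀ ρ → All WellFormed ρ → All NonzeroName (alits ρ)
  nonzeroNames []                []                             = []
  nonzeroNames ((a , b , c) ∷ ρ) ((nz-a , nz-b , nz-c , _) ∷ ws) = nz-a ∷ nz-b ∷ nz-c ∷ nonzeroNames ρ ws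

  Annotates : ℕ → (ℕ → Bool) → ALit → Set
  Annotates L α l = (length (digitsOf l) ≡ L) × (valueOf l ≡ α (variableOf l))

  annotate-stripLit : ∀ L α l → Annotates L α l → annotate L α (stripLit l) ≡ l
  annotate-stripLit L α (ds , s , v) (≡L , ≡α) =
    cong₂ _,_ (trans (cong (λ n → toBits n (fromBits ds)) (sym ≡L)) (toBits-fromBits ds)) (cong (s ,_) (sym ≡α))

  annotate-strip : ∀ L α ρ → All (Annotates L α) (alits ρ) → map (annotateClause L α) (map stripClause ρ) ≡ ρ
  annotate-strip L α []                _                     = refl
  annotate-strip L α ((a , b , c) ∷ ρ) (ann-a ∷ ann-b ∷ ann-c ∷ anns) =
    cong₂ _∷_ (cong₂ _,_ (annotate-stripLit L α a ann-a) (cong₂ _,_ (annotate-stripLit L α b ann-b) (annotate-stripLit L α c ann-c)))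
              (annotate-strip L α ρ anns)

  ∨-true : ∀ a b c → (a ∨ b) ∨ c ≡ true → (a ≡ true) ⊎ (b ≡ true) ⊎ (c ≡ true)
  ∨-true true  b     c    _ = inj₁ refl
  ∨-true false true  c    _ = inj₂ (inj₁ refl)
  ∨-true false false true _ = inj₂ (inj₂ refl)

  annotatedTrue⇒litTrue : ∀ L α l → Annotates L α l → annotatedTrue l ≡ true → litTrue α (stripLit l)
  annotatedTrue⇒litTrue L α (ds , s , v) (_ , ≡α) t = trans (sym ≡α) (sym (=ᵇ⇒≡ s v t))

  satisfied : ∀ L α ρ → All WellFormed ρ → All (Annotates L α) (alits ρ) →
    All (λ cl → Any (litTrue α) (clauseLits cl)) (map stripClause ρ)
  satisfied L α []                []                         _ = []
  satisfied L α ((a , b , c) ∷ ρ) ((_ , _ , _ , sat) ∷ ws) (ann-a ∷ ann-b ∷ ann-c ∷ anns)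
    with ∨-true (annotatedTrue a) (annotatedTrue b) (annotatedTrue c) sat
  ... | inj₁ t        = here (annotatedTrue⇒litTrue L α a ann-a t) ∷ satisfied L α ρ ws anns
  ... | inj₂ (inj₁ t) = there (here (annotatedTrue⇒litTrue L α b ann-b t)) ∷ satisfied L α ρ ws anns
  ... | inj₂ (inj₂ t) = there (there (here (annotatedTrue⇒litTrue L α c ann-c t))) ∷ satisfied L α ρ ws anns


certificate⇒ThreeSATNice : ∀ {x} (cert : Certificate x) →
  Σ Formula λ φ → HasVars (Certificate.k cert) φ × x ≡ encFormula (bits (Certificate.k cert)) φ × Satisfiable φ
certificate⇒ThreeSATNice {x} cert = φ , (names-in-range , all-names-occur) , x≡ , α , satisfied L α ρ wellFormed annotates
  where
    open Certificate cert
    L = bits k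
    ls = alits ρ
    nonzero = nonzeroNames ρ wellFormed
    α = assignmentOf ls
    φ = map stripClause ρ
    annotates : All (Annotates L α) ls
    annotates = All.tabulate λ {l} l∈ → All.lookup widths l∈ , sym (assignmentOf-consistent ls
      (λ {l₁} l₁∈ l₂∈ eq → consistent (variableOf l₁) (NonzeroName⇒1≤ (digitsOf l₁) (All.lookup nonzero l₁∈))
                             (All.lookup atMost l₁∈) l₁∈ l₂∈ refl (sym eq)) l∈)
    x≡ : x ≡ encFormula L φ
    x≡ = sym (map-injective inj₁-injective
           (trans (sym (erase-encAFormula L α φ)) (trans (cong (map erase ∘ encAFormula) (annotate-strip L α ρ annotates)) encodes)))
    names-in-range : ∀ {v} → v ∈ vars φ → 1 ≤ v × v ≤ k
    names-in-range {v} v∈ with ∈-map⁻ variableOf (subst (v ∈_) (vars-strip ρ) v∈)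
    ... | l , l∈ , refl = NonzeroName⇒1≤ (digitsOf l) (All.lookup nonzero l∈) , All.lookup atMost l∈
    all-names-occur : ∀ i → 1 ≤ i → i ≤ k → i ∈ vars φ
    all-names-occur i 1≤i i≤k with find (occurs i 1≤i i≤k)
    ... | l , l∈ , refl = subst (variableOf l ∈_) (sym (vars-strip ρ)) (∈-map⁺ variableOf l∈)

-- The counter checks on a guessed formula

module CounterChecks (ρ : AFormula) where
  ls = alits ρ

  pairs : ℕ → FormulaPair
  pairs j = liftAF (pairWithCounter j) ρ

  accepts-counter≡foldLits : ∀ (B : LiteralwiseAutomaton) j → let open Literalwise B in
    accepts (encAFormula ρ) (encAFormula (counterF j ρ))
      ≡ acceptsResult (foldLits (just (LiteralwiseAutomaton.global₀ B)) (map (pairWithCounter j) ls))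
  accepts-counter≡foldLits B j = trans (Literalwise.accepting-encAFormula B (pairs j) (leftF-pairWithCounter j ρ)
                                 (rightF-liftAF (pairWithCounter j) ρ) (sameLengths-pairWithCounter j ρ))
                              (cong (Literalwise.acceptsResult B ∘ Literalwise.foldLits B _) (litPairs-liftAF (pairWithCounter j) ρ))

  sameLengths-pairs : ∀ j → All SameLength (map (pairWithCounter j) ls)
  sameLengths-pairs j = subst (All SameLength) (litPairs-liftAF (pairWithCounter j) ρ) (sameLengths-pairWithCounter j ρ)

  bound-accepts≡allAtMost : ∀ j →
    Bound.accepts (encAFormula ρ) (encAFormula (counterF j ρ)) ≡ allAtMost true (map (pairWithCounter j) ls)
  bound-accepts≡allAtMost j = trans (accepts-counter≡foldLits boundAutomaton j)
    (cong Bound.acceptsResult (bound-fold true _ (sameLengths-pairs j)))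

  leadingOne-accepts≡allLeadingOne : ∀ k →
    LeadingOne.accepts (encAFormula (counterF k ρ)) (encAFormula (counterF k ρ)) ≡ allLeadingOne true (map (diagonal ∘ counterLit k) ls)
  leadingOne-accepts≡allLeadingOne k = begin
      LeadingOne.accepts (encAFormula (counterF k ρ)) (encAFormula (counterF k ρ))
    ≡⟨ LeadingOne.accepting-encAFormula diag (leftF-diagonal _) (rightF-diagonal _) (sameLengths-diagonal _) ⟩
      LeadingOne.acceptsResult (LeadingOne.foldLits (just true) (litPairs diag))
    ≡⟨ cong LeadingOne.acceptsResult (leadingOne-fold true _ (sameLengths-diagonal (counterF k ρ))) ⟩
      allLeadingOne true (litPairs diag)
    ≡⟨ cong (allLeadingOne true) (litPairs-liftAF diagonal (counterF k ρ)) ⟩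
      allLeadingOne true (map diagonal (alits (counterF k ρ)))
    ≡⟨ cong (allLeadingOne true) (trans (cong (map diagonal) (alits-mapAF (counterLit k) ρ)) (sym (map-∘ ls))) ⟩
      allLeadingOne true (map (diagonal ∘ counterLit k) ls)
    ∎
    where
      open ≡-Reasoning
      diag = liftAF diagonal (counterF k ρ)

  sameName⇒variable : ∀ j l → Fits j l → SameName (pairWithCounter j l) → variableOf l ≡ j
  sameName⇒variable j (ds , s , v) fit same = trans (cong fromBits same) (fromBits-toBits (length ds) j fit)

  variable⇒sameName : ∀ j l → variableOf l ≡ j → SameName (pairWithCounter j l)
  variable⇒sameName j (ds , s , v) refl = sym (toBits-fromBits ds)

  increment-sound : ∀ j C → All (Fits j) ls → Increment.accepts C (encAFormula (counterF j ρ)) ≡ true →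
    (C ≡ encAFormula (counterF (suc j) ρ)) × All (Fits (suc j)) ls
  increment-sound j C fits acc with Increment.parse-encAFormula (counterF j ρ) C acc
  ... | π , right≡ , eqs , refl with increment-step j π ρ right≡ eqs succs fits
    where
      succs : All IsSuccessor (litPairs π)
      succs = increment-fold-sound (litPairs π) eqs
                (trans (sym (Increment.accepting-encAFormula π refl right≡ eqs)) acc)
  ... | left≡ , fits′ = cong encAFormula left≡ , fits′

  occurrence-sound : ∀ j → All (Fits j) ls → Occurrence.accepts (encAFormula ρ) (encAFormula (counterF j ρ)) ≡ true →
    Any (λ l → variableOf l ≡ j) ls × Consistent j ls
  occurrence-sound j fits acc
    with Occurrence.foldLits (just (false , nothing)) (map (pairWithCounter j) ls) in run
       | trans (sym (accepts-counter≡foldLits occurrenceAutomaton j)) acc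
  ... | just (found , m) | found≡true
    with occurrence-fold-sound (map (pairWithCounter j) ls) false nothing found m (sameLengths-pairs j) run
  ... | values , found⇒ , _ with found⇒ found≡true
  ... | inj₂ some = occurs ls fits (Any.map⁻ some) , consistent
    where
      occurs : ∀ ls → All (Fits j) ls → Any (SameName ∘ pairWithCounter j) ls → Any (λ l → variableOf l ≡ j) ls
      occurs (l ∷ _)  (fit ∷ _)    (here same) = here (sameName⇒variable j l fit same)
      occurs (_ ∷ ls) (_ ∷ fits)   (there a)   = there (occurs ls fits a)
      value : ∀ {l} → l ∈ ls → variableOf l ≡ j → m ≡ just (valueOf l)
      value {l} l∈ eq = All.lookup (All.map⁻ values) l∈ (variable⇒sameName j l eq)
      consistent : Consistent j ls
      consistent l₁∈ l₂∈ eq₁ eq₂ = just-injective (trans (sym (value l₁∈ eq₁)) (value l₂∈ eq₂))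

  bound-sound : ∀ j → All (Fits j) ls → Bound.accepts (encAFormula ρ) (encAFormula (counterF j ρ)) ≡ true →
    All (λ l → variableOf l ≤ j) ls
  bound-sound j fits acc =
    atMost ls fits (All.map⁻ (allAtMost-sound _ (sameLengths-pairs j) (trans (sym (bound-accepts≡allAtMost j)) acc)))
    where
      atMost : ∀ ls → All (Fits j) ls → All (LeftAtMost ∘ pairWithCounter j) ls → All (λ l → variableOf l ≤ j) ls
      atMost []                 []           []         = []
      atMost ((ds , s , v) ∷ ls) (fit ∷ fits) (le ∷ les) =
        subst (fromBits ds ≤_) (fromBits-toBits (length ds) j fit) le ∷ atMost ls fits les

  leadingOne-sound : ∀ k → All (Fits k) ls →
    LeadingOne.accepts (encAFormula (counterF k ρ)) (encAFormula (counterF k ρ)) ≡ true →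
    All (λ l → length (digitsOf l) ≡ bits k) ls
  leadingOne-sound k fits acc =
    widths ls fits (All.map⁻ (allLeadingOne-sound _ (trans (sym (leadingOne-accepts≡allLeadingOne k)) acc)))
    where
      width : ∀ l → Fits k l → LeadingOneLeft (diagonal (counterLit k l)) → length (digitsOf l) ≡ bits k
      width (ds , s , v) fit lead = leadingOne⇒width (length ds) k fit lead
      widths : ∀ ls → All (Fits k) ls → All (LeadingOneLeft ∘ diagonal ∘ counterLit k) ls → All (λ l → length (digitsOf l) ≡ bits k) ls
      widths []       []           []           = []
      widths (l ∷ ls) (fit ∷ fits) (lead ∷ leads) = width l fit lead ∷ widths ls fits leads

  increment-complete : ∀ j → All (Fits (suc j)) ls →
    Increment.accepts (encAFormula (counterF (suc j) ρ)) (encAFormula (counterF j ρ)) ≡ true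
  increment-complete j fits = begin
      Increment.accepts (encAFormula (counterF (suc j) ρ)) (encAFormula (counterF j ρ))
    ≡⟨ Increment.accepting-encAFormula π (leftF-liftAF (incrementPair j) ρ) (rightF-liftAF (incrementPair j) ρ)
         (sameLengths-incrementPair j ρ) ⟩
      Increment.acceptsResult (Increment.foldLits (just tt) (litPairs π))
    ≡⟨ cong Increment.acceptsResult (increment-fold-complete _ (sameLengths-incrementPair j ρ) (isSuccessor-incrementPair j ρ fits)) ⟩
      true
    ∎
    where
      open ≡-Reasoning
      π = liftAF (incrementPair j) ρ

  occurrence-complete : ∀ j v₀ → All (Fits j) ls → Any (λ l → variableOf l ≡ j) ls →
    (∀ {l} → l ∈ ls → variableOf l ≡ j → valueOf l ≡ v₀) →
    Occurrence.accepts (encAFormula ρ) (encAFormula (counterF j ρ)) ≡ true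
  occurrence-complete j v₀ fits some values
    with occurrence-fold-complete (map (pairWithCounter j) ls) v₀ false nothing (sameLengths-pairs j)
           (All.map⁺ (All.tabulate λ {l} l∈ same → values l∈ (sameName⇒variable j l (All.lookup fits l∈) same)))
           (inj₁ refl)
  ... | found , m , run , found⇒ = trans (accepts-counter≡foldLits occurrenceAutomaton j)
          (trans (cong Occurrence.acceptsResult run) (found⇒ (inj₂ (Any.map⁺ (Any.map (λ {l} → variable⇒sameName j l) some)))))

  bound-complete : ∀ j → All (Fits j) ls → All (λ l → variableOf l ≤ j) ls →
    Bound.accepts (encAFormula ρ) (encAFormula (counterF j ρ)) ≡ true
  bound-complete j fits les = trans (bound-accepts≡allAtMost j)
    (allAtMost-complete _ (sameLengths-pairs j) (All.map⁺ (All.zipWith (λ { {ds , _ , _} (fit , le) →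
      subst (fromBits ds ≤_) (sym (fromBits-toBits (length ds) j fit)) le }) (fits , les))))

  bound-rejects : ∀ j → All (Fits j) ls → Any (λ l → j < variableOf l) ls →
    Bound.accepts (encAFormula ρ) (encAFormula (counterF j ρ)) ≡ false
  bound-rejects j fits some =
    trans (bound-accepts≡allAtMost j) (allAtMost-reject true _ (sameLengths-pairs j) (Any.map⁺ (greater ls fits some)))
    where
      greater : ∀ ls → All (Fits j) ls → Any (λ l → j < variableOf l) ls → Any (LeftGreater ∘ pairWithCounter j) ls
      greater ((ds , _ , _) ∷ _) (fit ∷ _) (here gt) = here (subst (_< fromBits ds) (sym (fromBits-toBits (length ds) j fit)) gt)
      greater (_ ∷ ls) (_ ∷ fits) (there a) = there (greater ls fits a)

  leadingOne-complete : ∀ k → 1 ≤ k → All (λ l → length (digitsOf l) ≡ bits k) ls →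
    LeadingOne.accepts (encAFormula (counterF k ρ)) (encAFormula (counterF k ρ)) ≡ true
  leadingOne-complete k 1≤k widths = trans (leadingOne-accepts≡allLeadingOne k)
    (allLeadingOne-complete _ (All.map⁺ (All.map (λ { {ds , _ , _} w →
      subst (λ n → headIsOne (toBits n k) ≡ true) (sym w) (width⇒leadingOne k 1≤k) }) widths)))

-- Annotating a satisfiable formula in nice format

literals : Formula → List Literal
literals []                = []
literals ((a , b , c) ∷ φ) = a ∷ b ∷ c ∷ literals φ

vars≡map-proj₁-literals : ∀ φ → vars φ ≡ map proj₁ (literals φ)
vars≡map-proj₁-literals []                                    = refl
vars≡map-proj₁-literals (((i , _) , (j , _) , (k , _)) ∷ φ) = cong (λ t → i ∷ j ∷ k ∷ t) (vars≡map-proj₁-literals φ)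

alits-annotate : ∀ L α φ → alits (map (annotateClause L α) φ) ≡ map (annotate L α) (literals φ)
alits-annotate L α []                = refl
alits-annotate L α ((a , b , c) ∷ φ) = cong (λ t → annotate L α a ∷ annotate L α b ∷ annotate L α c ∷ t) (alits-annotate L α φ)

module Annotated (k : ℕ) (φ : Formula) (α : ℕ → Bool) (hv : HasVars k φ) where
  L = bits k
  ρ = map (annotateClause L α) φ
  ls = alits ρ

  Good : ALit → Set
  Good l = (length (digitsOf l) ≡ L) × (1 ≤ variableOf l) × (variableOf l ≤ k) × (valueOf l ≡ α (variableOf l))

  variableOf-annotate : ∀ i s → i ≤ k → variableOf (annotate L α (i , s)) ≡ i
  variableOf-annotate i s i≤k = fromBits-toBits L i (≤-<-trans i≤k (n<2^[1+⌊log₂n⌋] k))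

  good : All Good ls
  good = subst (All Good) (sym (alits-annotate L α φ)) (All.map⁺ (All.tabulate λ {l} l∈ → good-lit l (in-range l∈)))
    where
      in-range : ∀ {l} → l ∈ literals φ → 1 ≤ proj₁ l × proj₁ l ≤ k
      in-range {l} l∈ = proj₁ hv (subst (proj₁ l ∈_) (sym (vars≡map-proj₁-literals φ)) (∈-map⁺ proj₁ l∈))
      good-lit : ∀ l → 1 ≤ proj₁ l × proj₁ l ≤ k → Good (annotate L α l)
      good-lit (i , s) (1≤i , i≤k) rewrite variableOf-annotate i s i≤k = length-toBits L i , 1≤i , i≤k , refl

  widths : All (λ l → length (digitsOf l) ≡ bits k) ls
  widths = All.map proj₁ good

  atMost : All (λ l → variableOf l ≤ k) ls
  atMost = All.map (proj₁ ∘ proj₂ ∘ proj₂) good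

  fits : ∀ j → j ≤ k → All (Fits j) ls
  fits j j≤k = All.map (λ {l} g → subst (λ n → j < 2 ^ n) (sym (proj₁ g)) (≤-<-trans j≤k (n<2^[1+⌊log₂n⌋] k))) good

  values : ∀ j {l} → l ∈ ls → variableOf l ≡ j → valueOf l ≡ α j
  values j l∈ refl = proj₂ (proj₂ (proj₂ (All.lookup good l∈)))

  occurs : ∀ j → 1 ≤ j → j ≤ k → Any (λ l → variableOf l ≡ j) ls
  occurs j 1≤j j≤k = subst (Any (λ l → variableOf l ≡ j)) (sym (alits-annotate L α φ))
    (Any.map⁺ (go (literals φ) (subst (j ∈_) (vars≡map-proj₁-literals φ) (proj₂ hv j 1≤j j≤k))))
    where
      go : ∀ ls → j ∈ map proj₁ ls → Any (λ l → variableOf (annotate L α l) ≡ j) ls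
      go ((i , s) ∷ ls) (here refl) = here (variableOf-annotate i s j≤k)
      go (l ∷ ls)       (there j∈)  = there (go ls j∈)

  wellFormed : All (λ cl → Any (litTrue α) (clauseLits cl)) φ → All WellFormed ρ
  wellFormed sat = go φ sat (subst (All Good) (alits-annotate L α φ) good)
    where
      nonzero : ∀ ds → 1 ≤ fromBits ds → or ds ≡ true
      nonzero []           ()
      nonzero (true ∷ ds)  _ = refl
      nonzero (false ∷ ds) 1≤ = nonzero ds 1≤
      litTrue⇒annotatedTrue : ∀ l → litTrue α l → annotatedTrue (annotate L α l) ≡ true
      litTrue⇒annotatedTrue (i , s) t rewrite t = =ᵇ-refl s
      go : ∀ φ → All (λ cl → Any (litTrue α) (clauseLits cl)) φ → All Good (map (annotate L α) (literals φ)) →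
           All WellFormed (map (annotateClause L α) φ)
      go [] [] _ = []
      go ((a , b , c) ∷ φ) (s ∷ ss) ((_ , 1≤a , _) ∷ (_ , 1≤b , _) ∷ (_ , 1≤c , _) ∷ gs) =
        (nonzero (toBits L (proj₁ a)) 1≤a , nonzero (toBits L (proj₁ b)) 1≤b , nonzero (toBits L (proj₁ c)) 1≤c , some-true s)
          ∷ go φ ss gs
        where
          some-true : Any (litTrue α) (a ∷ b ∷ c ∷ []) →
            (annotatedTrue (annotate L α a) ∨ annotatedTrue (annotate L α b)) ∨ annotatedTrue (annotate L α c) ≡ true
          some-true (here t) rewrite litTrue⇒annotatedTrue a t = refl
          some-true (there (here t)) rewrite litTrue⇒annotatedTrue b t | ∨-zeroʳ (annotatedTrue (annotate L α a)) = refl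
          some-true (there (there (here t)))
            rewrite litTrue⇒annotatedTrue c t | ∨-zeroʳ (annotatedTrue (annotate L α a) ∨ annotatedTrue (annotate L α b)) = refl

-- The machine

module StepInversion (M : NARM) where
  open NARM M
  open Semantics M hiding (Γ)

  Successor : List Sym → Instr (Sym ⊎ Fin extra) nreg (suc plen) → Config → Config → Set
  Successor x (readIn i)          (pc , R) c = ∃ λ pc′ → nextPC pc ≡ just pc′ × c ≡ (pc′ , update R i (map inj₁ x))
  Successor x (write i)           (pc , R) c = ∃ λ pc′ → nextPC pc ≡ just pc′ × c ≡ (pc′ , R)
  Successor x (const i w)         (pc , R) c = ∃ λ pc′ → nextPC pc ≡ just pc′ × c ≡ (pc′ , update R i w)
  Successor x (copy i j)          (pc , R) c = ∃ λ pc′ → nextPC pc ≡ just pc′ × c ≡ (pc′ , update R i (R j))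
  Successor x (choose i k js D _) (pc , R) c = ∃ λ pc′ → nextPC pc ≡ just pc′ ×
    ∃ λ y → acceptsDFA D (conv (y ∷ vals R js)) ≡ true × c ≡ (pc′ , update R i y)
  Successor x (goto l)            (pc , R) c = c ≡ (l , R)
  Successor x (ifGoto k js D l)   (pc , R) c =
    (acceptsDFA D (conv (vals R js)) ≡ true × c ≡ (l , R)) ⊎
    (acceptsDFA D (conv (vals R js)) ≡ false × ∃ λ pc′ → nextPC pc ≡ just pc′ × c ≡ (pc′ , R))
  Successor x halt   _ _ = ⊥
  Successor x accept _ _ = ⊥
  Successor x reject _ _ = ⊥

  step-inversion : ∀ {x pc R c} → Step x (pc , R) c → Successor x (prog pc) (pc , R) c
  step-inversion {x} {pc} {R} {c} step = go step
    where
      at : ∀ {I} → prog pc ≡ I → Successor x I (pc , R) c → Successor x (prog pc) (pc , R) c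
      at eq s = subst (λ I → Successor x I (pc , R) c) (sym eq) s
      go : Step x (pc , R) c → Successor x (prog pc) (pc , R) c
      go (s-read   eq nx)       = at eq (_ , nx , refl)
      go (s-write  eq nx)       = at eq (_ , nx , refl)
      go (s-const  eq nx)       = at eq (_ , nx , refl)
      go (s-copy   eq nx)       = at eq (_ , nx , refl)
      go (s-choose eq nx y acc) = at eq (_ , nx , y , acc , refl)
      go (s-goto   eq)          = at eq refl
      go (s-ifT    eq acc)      = at eq (inj₁ (acc , refl))
      go (s-ifF    eq acc nx)   = at eq (inj₂ (acc , _ , nx , refl))

  no-run-from-reject : ∀ {x pc R t} → prog pc ≡ reject → ¬ AccRun x (pc , R) t
  no-run-from-reject eq (acc-here eq′)     with () ← trans (sym eq) eq′
  no-run-from-reject eq (acc-step step _) = subst (λ I → Successor _ I _ _) eq (step-inversion step)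

  read-step : ∀ {x pc R t i} → prog pc ≡ readIn i → AccRun x (pc , R) t →
    ∃ λ pc′ → nextPC pc ≡ just pc′ × ∃ λ t′ → t ≡ suc t′ × AccRun x (pc′ , update R i (map inj₁ x)) t′
  read-step eq (acc-here eq′) with () ← trans (sym eq) eq′
  read-step eq (acc-step step run) with subst (λ I → Successor _ I _ _) eq (step-inversion step)
  ... | pc′ , nx , refl = pc′ , nx , _ , refl , run

  choice-step : ∀ {x pc R t i k js D b} → prog pc ≡ choose i k js D b → AccRun x (pc , R) t →
    ∃ λ y → acceptsDFA D (conv (y ∷ vals R js)) ≡ true ×
    ∃ λ pc′ → nextPC pc ≡ just pc′ × ∃ λ t′ → t ≡ suc t′ × AccRun x (pc′ , update R i y) t′
  choice-step eq (acc-here eq′) with () ← trans (sym eq) eq′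
  choice-step eq (acc-step step run) with subst (λ I → Successor _ I _ _) eq (step-inversion step)
  ... | pc′ , nx , y , acc , refl = y , acc , pc′ , nx , _ , refl , run

  guard-passes : ∀ {x pc R t k js D l} → prog pc ≡ ifGoto k js D l → prog l ≡ reject → AccRun x (pc , R) t →
    acceptsDFA D (conv (vals R js)) ≡ false × ∃ λ pc′ → nextPC pc ≡ just pc′ × ∃ λ t′ → t ≡ suc t′ × AccRun x (pc′ , R) t′
  guard-passes eq rej (acc-here eq′) with () ← trans (sym eq) eq′
  guard-passes eq rej (acc-step step run) with subst (λ I → Successor _ I _ _) eq (step-inversion step)
  ... | inj₁ (_ , refl)              = ⊥-elim (no-run-from-reject rej run)
  ... | inj₂ (fails , pc′ , nx , refl) = fails , pc′ , nx , _ , refl , run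

  branch-step : ∀ {x pc R t k js D l} → prog pc ≡ ifGoto k js D l → AccRun x (pc , R) t →
    ∃ λ t′ → t ≡ suc t′ × ((acceptsDFA D (conv (vals R js)) ≡ true × AccRun x (l , R) t′) ⊎
                           (acceptsDFA D (conv (vals R js)) ≡ false × ∃ λ pc′ → nextPC pc ≡ just pc′ × AccRun x (pc′ , R) t′))
  branch-step eq (acc-here eq′) with () ← trans (sym eq) eq′
  branch-step eq (acc-step step run) with subst (λ I → Successor _ I _ _) eq (step-inversion step)
  ... | inj₁ (holds , refl)            = _ , refl , inj₁ (holds , run)
  ... | inj₂ (fails , pc′ , nx , refl) = _ , refl , inj₂ (fails , pc′ , nx , run)

  goto-step : ∀ {x pc R t l} → prog pc ≡ goto l → AccRun x (pc , R) t → ∃ λ t′ → t ≡ suc t′ × AccRun x (l , R) t′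
  goto-step eq (acc-here eq′) with () ← trans (sym eq) eq′
  goto-step eq (acc-step step run) with subst (λ I → Successor _ I _ _) eq (step-inversion step)
  ... | refl = _ , refl , run

  run-from-accept : ∀ {x pc R t} → prog pc ≡ accept → AccRun x (pc , R) t → t ≡ 1
  run-from-accept eq (acc-here _)       = refl
  run-from-accept eq (acc-step step _) = ⊥-elim (subst (λ I → Successor _ I _ _) eq (step-inversion step))

module Annotation = Graph _≟Γ_ erase
module Zeroing    = Graph _≟Γ_ zeroDigits

rX rA rC : Fin 3
rX = zero
rA = suc zero
rC = suc (suc zero)

-- Register rX holds the input x, rA a guessed annotated formula A, and rC the counter word.
-- Lines 2–4: guess A with erase A = x, reject unless A is a well-formed satisfied formula, set
-- rC to the counter word of 0.  Loop 5–8: increment rC, reject unless variable j occurs in A with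
-- a consistent value, and leave once no name in A exceeds j.  Line 9 checks that the final
-- counter k is written without leading zeros, i.e. that names have bits k digits.
program : Vec (Instr Γ 3 12) 12
program =
    readIn rX
  ∷ ifGoto 2 (rX ∷ rX ∷ []) Emptiness.toDFA (# 10)
  ∷ choose rA 1 (rX ∷ []) Annotation.Right.toDFA Annotation.Right.toDFA-bounded
  ∷ ifGoto 2 (rA ∷ rA ∷ []) Syntax.toDFAᶜ (# 11)
  ∷ choose rC 1 (rA ∷ []) Zeroing.Left.toDFA Zeroing.Left.toDFA-bounded
  ∷ choose rC 1 (rC ∷ []) Increment.toDFA Increment.toDFA-bounded
  ∷ ifGoto 2 (rA ∷ rC ∷ []) Occurrence.toDFAᶜ (# 11)
  ∷ ifGoto 2 (rA ∷ rC ∷ []) Bound.toDFA (# 9)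
  ∷ goto (# 5)
  ∷ ifGoto 2 (rC ∷ rC ∷ []) LeadingOne.toDFAᶜ (# 11)
  ∷ accept
  ∷ reject
  ∷ []

machine : NARM
machine = record { extra = 4 ; nreg = 3 ; plen = 11 ; prog = lookup program }

open Semantics machine using (Step; AccRun; init; update; Accepts; s-read; s-choose; s-goto; s-ifT; s-ifF; acc-here; acc-step)
open StepInversion machine

-- Soundness of the machine

one-more-pass : ∀ m → 4 + (5 + 4 * m) ≡ 5 + 4 * suc m
one-more-pass m = cong (5 +_) (sym (*-suc 4 m))

total-steps : ∀ m → 5 + (5 + 4 * m) ≡ 4 * suc m + 6
total-steps m = trans (cong (4 +_) (+-comm 6 (4 * m))) (cong (_+ 6) (sym (*-suc 4 m)))

module LoopSoundness (x : List Sym) (ρ : AFormula) where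
  open CounterChecks ρ

  CheckedUpTo : ℕ → Set
  CheckedUpTo j = ∀ i → 1 ≤ i → i ≤ j → Any (λ l → variableOf l ≡ i) ls × Consistent i ls

  record LoopExit (k : ℕ) : Set where
    field
      widths  : All (λ l → length (digitsOf l) ≡ bits k) ls
      atMost  : All (λ l → variableOf l ≤ k) ls
      checked : CheckedUpTo k

  checked-suc : ∀ j → CheckedUpTo j → Any (λ l → variableOf l ≡ suc j) ls → Consistent (suc j) ls → CheckedUpTo (suc j)
  checked-suc j done occ cons i 1≤i i≤1+j with m≤n⇒m<n∨m≡n i≤1+j
  ... | inj₁ i<1+j = done i 1≤i (≤-pred i<1+j)
  ... | inj₂ refl  = occ , cons

  A : List Γ
  A = encAFormula ρ

  counter : ℕ → List Γ
  counter j = encAFormula (counterF j ρ)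

  -- From line 5 with counter j, the run makes m + 1 more passes through the loop and leaves it with k = j + m + 1.
  loop-sound : ∀ j {R t} → R rA ≡ A → R rC ≡ counter j → All (Fits j) ls → CheckedUpTo j →
    AccRun x (# 5 , R) t → ∃ λ m → t ≡ 5 + 4 * m × LoopExit (j + suc m)
  loop-sound j {R} A≡ C≡ fits done r₅
    with choice-step refl r₅
  ... | C , increments , _ , refl , _ , refl , r₆
    with increment-sound j C fits (subst (λ w → Increment.accepts C w ≡ true) C≡ (Increment.toDFA⇒accepts C (R rC) increments))
  ... | refl , fits′
    with guard-passes refl refl r₆
  ... | rej₆ , _ , refl , _ , refl , r₇
    with occurrence-sound (suc j) fits′
           (subst (λ w → Occurrence.accepts w (counter (suc j)) ≡ true) A≡ (Occurrence.toDFAᶜ⇒accepts (R rA) (counter (suc j)) rej₆))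
  ... | occ , cons
    with branch-step refl r₇
  ... | _ , refl , inj₁ (bounded , r₉)
    with guard-passes refl refl r₉
  ... | rej₉ , _ , refl , _ , refl , r₁₀
    with run-from-accept refl r₁₀
  ... | refl = 0 , refl , subst LoopExit (+-comm 1 j) record
    { widths  = leadingOne-sound (suc j) fits′ (LeadingOne.toDFAᶜ⇒accepts (counter (suc j)) (counter (suc j)) rej₉)
    ; atMost  = bound-sound (suc j) fits′
                  (subst (λ w → Bound.accepts w (counter (suc j)) ≡ true) A≡ (Bound.toDFA⇒accepts (R rA) (counter (suc j)) bounded))
    ; checked = checked-suc j done occ cons }
  loop-sound j {R} A≡ C≡ fits done r₅ | C , _ , _ , refl , _ , refl , r₆ | refl , fits′ | _ , _ , refl , _ , refl , r₇
    | occ , cons | _ , refl , inj₂ (_ , _ , refl , r₈)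
    with goto-step refl r₈
  ... | _ , refl , r₅′
    with loop-sound (suc j) A≡ refl fits′ (checked-suc j done occ cons) r₅′
  ... | m , refl , exit = suc m , one-more-pass m , subst LoopExit (sym (+-suc j (suc m))) exit

run-sound : ∀ x t → AccRun x init t →
  (x ≡ [] × t ≡ 3) ⊎ Σ (Certificate x) λ cert → t ≡ 4 * Certificate.k cert + 6 × 1 ≤ Certificate.k cert
run-sound x t r₀
  with read-step refl r₀
... | _ , refl , _ , refl , r₁
  with branch-step refl r₁
... | _ , refl , inj₁ (empty , r₁₀) with run-from-accept refl r₁₀
...   | refl = inj₁ (map-inj₁≡[] x (emptiness-accepts⇒[] X X (Emptiness.toDFA⇒accepts X X empty)) , refl)
  where
    X = map inj₁ x
    map-inj₁≡[] : ∀ (x : List Sym) → map (inj₁ {B = Fin 4}) x ≡ [] → x ≡ []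
    map-inj₁≡[] [] _ = refl
run-sound x t r₀ | _ , refl , _ , refl , r₁ | _ , refl , inj₂ (_ , _ , refl , r₂)
  with choice-step refl r₂
... | A , annotates , _ , refl , _ , refl , r₃
  with guard-passes refl refl r₃
... | rej₃ , _ , refl , _ , refl , r₄
  with syntax-sound A (Syntax.toDFAᶜ⇒accepts A A rej₃)
... | c , ρ′ , refl , wellFormed
  with choice-step refl r₄
... | C , zeroes , _ , refl , _ , refl , r₅
  with Zeroing.accepts-left-sound C A (Zeroing.Left.toDFA⇒accepts C A zeroes)
... | refl
  with LoopSoundness.loop-sound x (c ∷ ρ′) 0 refl (map-zeroDigits-encAFormula (c ∷ ρ′))
         (All.tabulate λ {l} _ → m^n>0 2 (length (digitsOf l))) (λ i 1≤i i≤0 → ⊥-elim (<⇒≱ 1≤i i≤0)) r₅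
... | m , refl , exit = inj₂ (certificate , total-steps m , s≤s z≤n)
  where
    open LoopSoundness.LoopExit exit
    certificate : Certificate x
    certificate = record
      { ρ = c ∷ ρ′ ; k = suc m
      ; encodes = sym (Annotation.accepts-right-sound A (map inj₁ x) (Annotation.Right.toDFA⇒accepts A (map inj₁ x) annotates))
      ; wellFormed = wellFormed ; widths = widths ; atMost = atMost
      ; occurs = λ j 1≤j j≤k → proj₁ (checked j 1≤j j≤k)
      ; consistent = λ j 1≤j j≤k → proj₂ (checked j 1≤j j≤k) }

-- Input length

private
  remove : ∀ {y : ℕ} xs → y ∈ xs → List ℕ
  remove (x ∷ xs) (here _)  = xs
  remove (x ∷ xs) (there m) = x ∷ remove xs m

  length-remove : ∀ {y : ℕ} xs (m : y ∈ xs) → length xs ≡ suc (length (remove xs m))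
  length-remove (x ∷ xs) (here _)  = refl
  length-remove (x ∷ xs) (there m) = cong suc (length-remove xs m)

  ∈-remove : ∀ {y i : ℕ} xs (m : y ∈ xs) → i ∈ xs → i ≢ y → i ∈ remove xs m
  ∈-remove (x ∷ xs) (here refl) (here refl) i≢y = ⊥-elim (i≢y refl)
  ∈-remove (x ∷ xs) (here _)    (there i∈)  _   = i∈
  ∈-remove (x ∷ xs) (there m)   (here refl) _   = here refl
  ∈-remove (x ∷ xs) (there m)   (there i∈)  i≢y = there (∈-remove xs m i∈ i≢y)

covering⇒k≤length : ∀ k (xs : List ℕ) → (∀ i → 1 ≤ i → i ≤ k → i ∈ xs) → k ≤ length xs
covering⇒k≤length zero    xs _      = z≤n
covering⇒k≤length (suc k) xs covers =
  subst (suc k ≤_) (sym (length-remove xs k+1∈)) (s≤s (covering⇒k≤length k (remove xs k+1∈) covers′))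
  where
    k+1∈ : suc k ∈ xs
    k+1∈ = covers (suc k) (s≤s z≤n) ≤-refl
    covers′ : ∀ i → 1 ≤ i → i ≤ k → i ∈ remove xs k+1∈
    covers′ i 1≤i i≤k = ∈-remove xs k+1∈ (covers i 1≤i (≤-trans i≤k (n≤1+n k))) (<⇒≢ (s≤s i≤k))

private
  length-encLit : ∀ L l (Y : List Sym) → L + length Y ≤ length (encLit L l ++ Y)
  length-encLit L (i , s) Y = begin
      L + length Y                                                 ≤⟨ +-monoʳ-≤ L (n≤1+n (length Y)) ⟩
      L + (1 + length Y)                                           ≡⟨ cong (_+ (1 + length Y)) (sym (length-bin L i)) ⟩
      length (bin L i) + length ((if s then plus else minus) ∷ Y) ≡⟨ sym (length-++ (bin L i)) ⟩
      length (bin L i ++ (if s then plus else minus) ∷ Y)         ≡⟨ cong length (sym (++-assoc (bin L i) _ Y)) ⟩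
      length (encLit L (i , s) ++ Y)                               ∎
    where open ≤-Reasoning

  length-encClause : ∀ L c (Y : List Sym) → L + (L + (L + length Y)) ≤ length (encClause L c ++ Y)
  length-encClause L (a , b , c) Y = begin
      L + (L + (L + length Y))                                    ≤⟨ +-monoʳ-≤ L (+-monoʳ-≤ L (length-encLit L c Y)) ⟩
      L + (L + length (encLit L c ++ Y))                          ≤⟨ +-monoʳ-≤ L (+-monoʳ-≤ L (n≤1+n _)) ⟩
      L + (L + length (bar ∷ encLit L c ++ Y))                    ≤⟨ +-monoʳ-≤ L (length-encLit L b _) ⟩
      L + length (encLit L b ++ bar ∷ encLit L c ++ Y)            ≤⟨ +-monoʳ-≤ L (n≤1+n _) ⟩
      L + length (bar ∷ encLit L b ++ bar ∷ encLit L c ++ Y)      ≤⟨ length-encLit L a _ ⟩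
      length (encLit L a ++ bar ∷ encLit L b ++ bar ∷ encLit L c ++ Y) ≡⟨ cong length (sym assoc) ⟩
      length (encClause L (a , b , c) ++ Y)                       ∎
    where
      open ≤-Reasoning
      assoc : encClause L (a , b , c) ++ Y ≡ encLit L a ++ bar ∷ encLit L b ++ bar ∷ encLit L c ++ Y
      assoc = trans (++-assoc (encLit L a) (bar ∷ encLit L b ++ bar ∷ encLit L c) Y)
                    (cong (λ t → encLit L a ++ bar ∷ t) (++-assoc (encLit L b) (bar ∷ encLit L c) Y))

  length-vars*L≤length-encFormula : ∀ L φ → length (vars φ) * L ≤ length (encFormula L φ)
  length-vars*L≤length-encFormula L []           = z≤n
  length-vars*L≤length-encFormula L (c ∷ [])     =
    subst (L + (L + (L + 0)) ≤_) (cong length (++-identityʳ (encClause L c))) (length-encClause L c [])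
  length-vars*L≤length-encFormula L (((i , _) , (j , _) , (k , _)) ∷ c′ ∷ φ) = begin
      L + (L + (L + length (vars (c′ ∷ φ)) * L))
        ≤⟨ +-monoʳ-≤ L (+-monoʳ-≤ L (+-monoʳ-≤ L (≤-trans (length-vars*L≤length-encFormula L (c′ ∷ φ)) (n≤1+n _)))) ⟩
      L + (L + (L + length (amp ∷ encFormula L (c′ ∷ φ))))
        ≤⟨ length-encClause L _ _ ⟩
      length (encFormula L (((i , _) , (j , _) , (k , _)) ∷ c′ ∷ φ)) ∎
    where open ≤-Reasoning

k*bits[k]≤length : ∀ k φ → HasVars k φ → k * bits k ≤ length (encFormula (bits k) φ)
k*bits[k]≤length k φ hv =
  ≤-trans (*-monoˡ-≤ (bits k) (covering⇒k≤length k (vars φ) (proj₂ hv))) (length-vars*L≤length-encFormula (bits k) φ)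

-- Completeness of the machine

HasVars⇒1≤k : ∀ k c φ → HasVars k (c ∷ φ) → 1 ≤ k
HasVars⇒1≤k k ((i , _) , _) φ (in-range , _) = ≤-trans (proj₁ (in-range (here refl))) (proj₂ (in-range (here refl)))

module RunCompleteness (k : ℕ) (c : Clause) (φ′ : Formula) (α : ℕ → Bool) (hv : HasVars k (c ∷ φ′))
                       (sat : All (λ cl → Any (litTrue α) (clauseLits cl)) (c ∷ φ′)) where
  open Annotated k (c ∷ φ′) α hv
  open CounterChecks ρ using (increment-complete; occurrence-complete; bound-complete; bound-rejects; leadingOne-complete)

  x : List Sym
  x = encFormula (bits k) (c ∷ φ′)

  A : List Γ
  A = encAFormula ρ

  counter : ℕ → List Γ
  counter j = encAFormula (counterF j ρ)

  1≤k : 1 ≤ k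
  1≤k = HasVars⇒1≤k k c φ′ hv

  loop-complete : ∀ m j {R} → j + suc m ≡ k → R rA ≡ A → R rC ≡ counter j → AccRun x (# 5 , R) (5 + 4 * m)
  loop-complete m j {R} j+1+m≡k A≡ C≡ =
    acc-step (s-choose refl refl C′ increments) (acc-step (s-ifF refl occurs-consistently refl) (leave-or-repeat m j+1+m≡k))
    where
      C′ = counter (suc j)
      j<k : j < k
      j<k = subst (j <_) j+1+m≡k (m<m+n j (s≤s z≤n))
      fits′ = fits (suc j) j<k
      increments : acceptsDFA Increment.toDFA (conv (C′ ∷ R rC ∷ [])) ≡ true
      increments = subst (λ w → acceptsDFA Increment.toDFA (conv (C′ ∷ w ∷ [])) ≡ true) (sym C≡)
        (Increment.accepts⇒toDFA C′ (counter j) (increment-complete j fits′))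
      at-A : ∀ D {b} → acceptsDFA D (conv (A ∷ C′ ∷ [])) ≡ b → acceptsDFA D (conv (R rA ∷ C′ ∷ [])) ≡ b
      at-A D {b} = subst (λ w → acceptsDFA D (conv (w ∷ C′ ∷ [])) ≡ b) (sym A≡)
      occurs-consistently : acceptsDFA Occurrence.toDFAᶜ (conv (R rA ∷ C′ ∷ [])) ≡ false
      occurs-consistently = at-A Occurrence.toDFAᶜ (Occurrence.accepts⇒toDFAᶜ A C′
        (occurrence-complete (suc j) (α (suc j)) fits′ (occurs (suc j) (s≤s z≤n) j<k) (values (suc j))))
      leave-or-repeat : ∀ m → j + suc m ≡ k → AccRun x (# 7 , update R rC C′) (3 + 4 * m)
      leave-or-repeat zero j+1≡k =
        acc-step (s-ifT refl within-bound) (acc-step (s-ifF refl leading-one refl) (acc-here refl))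
        where
          k≡1+j : k ≡ suc j
          k≡1+j = sym (trans (+-comm 1 j) j+1≡k)
          within-bound : acceptsDFA Bound.toDFA (conv (R rA ∷ C′ ∷ [])) ≡ true
          within-bound = at-A Bound.toDFA (Bound.accepts⇒toDFA A C′
            (bound-complete (suc j) fits′ (subst (λ n → All (λ l → variableOf l ≤ n) ls) k≡1+j atMost)))
          leading-one : acceptsDFA LeadingOne.toDFAᶜ (conv (C′ ∷ C′ ∷ [])) ≡ false
          leading-one = LeadingOne.accepts⇒toDFAᶜ C′ C′
            (subst (λ n → LeadingOne.accepts (counter n) (counter n) ≡ true) k≡1+j (leadingOne-complete k 1≤k widths))
      leave-or-repeat (suc m) j+2+m≡k =
        subst (AccRun x (# 7 , update R rC C′)) (cong (3 +_) (sym (*-suc 4 m)))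
          (acc-step (s-ifF refl beyond-bound refl)
            (acc-step (s-goto refl) (loop-complete m (suc j) j+1+[1+m]≡k A≡ refl)))
        where
          j+1+[1+m]≡k : suc j + suc m ≡ k
          j+1+[1+m]≡k = trans (sym (+-suc j (suc m))) j+2+m≡k
          1+j<k : suc j < k
          1+j<k = subst (suc j <_) j+1+[1+m]≡k (m<m+n (suc j) (s≤s z≤n))
          beyond-bound : acceptsDFA Bound.toDFA (conv (R rA ∷ C′ ∷ [])) ≡ false
          beyond-bound = at-A Bound.toDFA (Bound.accepts⇒toDFA A C′
            (bound-rejects (suc j) fits′ (Any.map (λ { refl → 1+j<k }) (occurs k 1≤k ≤-refl))))

  run-complete : AccRun x init (4 * k + 6)
  run-complete = subst (AccRun x init) (trans (total-steps (pred k)) (cong (λ n → 4 * n + 6) k≡))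
    (acc-step (s-read refl refl)
    (acc-step (s-ifF refl (Emptiness.accepts⇒toDFA X X (nonempty x x≢[])) refl)
    (acc-step (s-choose refl refl A (Annotation.Right.accepts⇒toDFA A X annotation))
    (acc-step (s-ifF refl (Syntax.accepts⇒toDFAᶜ A A (syntax-complete _ _ (wellFormed sat))) refl)
    (acc-step (s-choose refl refl C₀ (Zeroing.Left.accepts⇒toDFA C₀ A (Zeroing.accepts-left-complete A)))
    (loop-complete (pred k) 0 k≡ refl (map-zeroDigits-encAFormula ρ)))))))
    where
      X = map inj₁ x
      C₀ = map zeroDigits A
      k≡ : suc (pred k) ≡ k
      k≡ = suc-pred k {{>-nonZero 1≤k}}
      x≢[] : 1 ≤ length x
      x≢[] = ≤-trans (*-mono-≤ 1≤k (s≤s z≤n)) (k*bits[k]≤length k (c ∷ φ′) hv)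
      nonempty : ∀ (w : List Sym) → 1 ≤ length w → Emptiness.accepts (map inj₁ w) (map inj₁ w) ≡ false
      nonempty (s ∷ w) _ = emptiness-rejects-∷ (inj₁ s) (map inj₁ w)
      annotation : Annotation.Right.accepts A X ≡ true
      annotation = subst (λ t → Annotation.Right.accepts A t ≡ true) (erase-encAFormula (bits k) α (c ∷ φ′))
                         (Annotation.accepts-right-complete A)

machine-complete : ∀ x → ThreeSATNice x → Accepts x
machine-complete .[] (k , []     , _  , refl , _)       = 3 , acc-step (s-read refl refl) (acc-step (s-ifT refl refl) (acc-here refl))
machine-complete x   (k , c ∷ φ′ , hv , refl , α , sat) = 4 * k + 6 , RunCompleteness.run-complete k c φ′ α hv sat

machine-sound : ∀ x → Accepts x → ThreeSATNice x
machine-sound x (t , run) with run-sound x t run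
... | inj₁ (refl , _) = 0 , [] , ((λ ()) , λ i 1≤i i≤0 → ⊥-elim (<⇒≱ 1≤i i≤0)) , refl , (λ _ → false) , []
... | inj₂ (cert , _) = Certificate.k cert , certificate⇒ThreeSATNice cert

machine-time : ∀ x t → 1 ≤ length x → AccRun x init t → t ≤ 30 * nOverLog (length x)
machine-time x t 1≤|x| run with run-sound x t run
... | inj₁ (refl , _) with () ← 1≤|x|
... | inj₂ (cert , refl , 1≤k) with certificate⇒ThreeSATNice cert
... | φ , hv , x≡ , _ =
  4k+6≤30*nOverLog k (length x) 1≤k (subst (λ w → k * bits k ≤ length w) (sym x≡) (k*bits[k]≤length k φ hv))
  where k = Certificate.k cert

mainTheorem13 : BNAL nOverLog ThreeSATNice
mainTheorem13 = machine , (λ x → mk⇔ (machine-complete x) (machine-sound x)) , 30 , 1 , machine-time
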